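{- For every integer $n\geq 2$, the Schultz index of the pentagonal cylinder chain $P_n$ is \[\operatorname{Sc}(P_n)=\begin{cases}35n^3+48n^2+2n, & n \text{ even},\\ 35n^3+48n^2+n, & n \text{ odd}.\end{cases}\]
   Context: For $n\geq 2$, $P_n$ has vertex set $\{u_1,\dots,u_{2n}\}\cup\{u'_1,\dots,u'_{2n}\}\cup\{w_1,\dots,w_n\}$ and edges $u_ku_{k+1}$, $u'_ku'_{k+1}$ ($1\le k\le 2n-1$), $u_{2n}u_1$, $u'_{2n}u'_1$, $u_{2k-1}u'_{2k-1}$ ($1\le k\le n$), and $u_{2k}w_k$, $w_ku'_{2k}$ ($1\le k\le n$). For a connected graph with vertices $v_1,\dots,v_N$, degrees $d_i$ and shortest-path distances $d_{ij}$, the Schultz index is $\operatorname{Sc}(G)=\frac12\sum_{i=1}^N\sum_{j=1}^N (d_i+d_j)d_{ij}$. -}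

module Defs where

open import Data.Nat using (ℕ; zero; suc; _+_; _*_; _∸_; _≡ᵇ_; _/_)
open import Data.Bool using (Bool; true; false; _∧_; _∨_; not)
open import Data.Fin using (Fin; toℕ)
open import Data.List using (List; []; _∷_; map; _++_; allFin; upTo; length; filter)
open import Data.Nat.ListAction using (sum)
open import Data.Bool.ListAction using (any)
open import Relation.Nullary.Decidable using (does)
open import Data.Bool.Properties using (T?)

-- Vertices of the pentagonal cylinder chain P_n (0-based indices):
--   u i  stands for u_{i+1}   (i < 2n)
--   u' i stands for u'_{i+1}  (i < 2n)
--   w j  stands for w_{j+1}   (j < n)
data Vtx (n : ℕ) : Set where
  u  : Fin (2 * n) → Vtx n
  u' : Fin (2 * n) → Vtx n
  w  : Fin n → Vtx n

vertices : (n : ℕ) → List (Vtx n)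
vertices n = map u (allFin (2 * n)) ++ map u' (allFin (2 * n)) ++ map w (allFin n)

eqV : ∀ {n} → Vtx n → Vtx n → Bool
eqV (u a)  (u b)  = toℕ a ≡ᵇ toℕ b
eqV (u' a) (u' b) = toℕ a ≡ᵇ toℕ b
eqV (w a)  (w b)  = toℕ a ≡ᵇ toℕ b
eqV _ _ = false

cyc : ℕ → ℕ → ℕ → Bool
cyc m a b = (suc a ≡ᵇ b) ∨ (suc b ≡ᵇ a)
          ∨ ((a ≡ᵇ 0) ∧ (b ≡ᵇ (m ∸ 1))) ∨ ((b ≡ᵇ 0) ∧ (a ≡ᵇ (m ∸ 1)))

isEven : ℕ → Bool
isEven zero = true
isEven (suc k) = not (isEven k)

-- the edges of P_n
--   u_k u_{k+1}, u_{2n} u_1 ; u'_k u'_{k+1}, u'_{2n} u'_1   (two 2n-cycles)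
--   u_{2k-1} u'_{2k-1}   (0-based: u i — u' i with i even)
--   u_{2k} w_k, w_k u'_{2k}  (0-based: u i — w j and w j — u' i with i = 2j+1)
adj : ∀ {n} → Vtx n → Vtx n → Bool
adj {n} (u a)  (u b)  = cyc (2 * n) (toℕ a) (toℕ b)
adj {n} (u' a) (u' b) = cyc (2 * n) (toℕ a) (toℕ b)
adj (u a)  (u' b) = (toℕ a ≡ᵇ toℕ b) ∧ isEven (toℕ a)
adj (u' a) (u b)  = (toℕ a ≡ᵇ toℕ b) ∧ isEven (toℕ a)
adj (u a)  (w j)  = toℕ a ≡ᵇ suc (2 * toℕ j)
adj (w j)  (u a)  = toℕ a ≡ᵇ suc (2 * toℕ j)
adj (u' a) (w j)  = toℕ a ≡ᵇ suc (2 * toℕ j)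
adj (w j)  (u' a) = toℕ a ≡ᵇ suc (2 * toℕ j)
adj (w _)  (w _)  = false

order : ℕ → ℕ
order n = length (vertices n)

deg : ∀ {n} → Vtx n → ℕ
deg {n} x = length (filter (λ y → T? (adj x y)) (vertices n))

reach : ∀ {n} → ℕ → Vtx n → Vtx n → Bool
reach zero x y = eqV x y
reach {n} (suc k) x y = reach k x y ∨ any (λ z → reach k x z ∧ adj z y) (vertices n)

-- shortest-path distance: the least k with reach k x y.  Since reach is
-- monotone in k and P_n is connected (every distance is < order n), this
-- equals the number of k < order n with ¬ reach k x y.
dist : ∀ {n} → Vtx n → Vtx n → ℕ
dist {n} x y = length (filter (λ k → T? (not (reach k x y))) (upTo (order n)))

-- Schultz index: Sc(G) = 1/2 Σ_i Σ_j (d_i + d_j) d_ij  (the double sum is even)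
schultzDoubleSum : ℕ → ℕ
schultzDoubleSum n =
  sum (map (λ x → sum (map (λ y → (deg x + deg y) * dist x y) (vertices n))) (vertices n))

Sc : ℕ → ℕ
Sc n = schultzDoubleSum n / 2

-- Distances are certified rather than searched for: a labelling ℓ of the vertices that vanishes
-- exactly at x, grows by at most one along each edge, and lets every positive label be decreased
-- by one along some edge, is the distance from x.  Such labellings are written down explicitly for
-- the sources u₁, u₂ and w₁, in terms of the distance min(b, 2n ∸ b) on a 2n-cycle.  Turning the
-- chain by one pentagon and swapping the two 2n-cycles are automorphisms whose orbits are those of
-- u₁ (size 2n), u₂ (size 2n) and w₁ (size n), so the double sum Σₓ Σ_y (d_x + d_y) d(x, y) equals
-- 2n times the rows of u₁ and u₂ plus n times the row of w₁.  Everything then reduces to sums of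
-- cycle distances; the parity of n enters through the even-position sum, which is ⌊n²/2⌋.

module Submission where

open import Defs
open import Data.Nat
open import Data.Nat.Properties
open import Data.Nat.DivMod using (_mod_; m<n⇒m%n≡m; m%n<n; m≡m%n+[m/n]*n; m*n/n≡m)
open import Data.Nat.ListAction using (sum)
open import Data.Nat.ListAction.Properties using (sum-++)
open import Data.Nat.Tactic.RingSolver using (solve-∀)
open import Data.Bool using (Bool; true; false; T; not; _∧_; _∨_; if_then_else_)
open import Data.Bool.Properties using (T-∨; T-∧; T?; ∨-comm; not-involutive)
open import Data.Bool.ListAction using (any; or)
open import Data.Unit using (tt)
open import Data.Empty using (⊥-elim)
open import Data.Product using (∃; _×_; _,_; proj₁; proj₂)
open import Data.Sum using (_⊎_; inj₁; inj₂; [_,_])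
open import Data.Fin using (Fin; toℕ)
open import Data.Fin.Properties using (toℕ-injective; toℕ<n; toℕ-fromℕ<)
open import Data.List using (List; []; _∷_; map; _++_; filter; length; applyUpTo; allFin; tabulate; upTo)
open import Data.List.Properties using (map-++; map-cong; map-tabulate; map-∘; length-++; length-map; length-tabulate)
open import Data.List.Membership.Propositional using (_∈_; lose)
open import Data.List.Membership.Propositional.Properties using (∈-map⁺; ∈-++⁺ˡ; ∈-++⁺ʳ; ∈-allFin)
open import Data.List.Relation.Unary.Any using (satisfied)
open import Data.List.Relation.Unary.Any.Properties using (any⁺; any⁻)
open import Function using (_∘_; _⇔_; mk⇔; Equivalence)
open import Relation.Nullary using (¬_; yes; no)
open import Relation.Binary.PropositionalEquality hiding ([_])
open ≡-Reasoning
open Equivalence using (to; from)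

-- Sums over initial segments of ℕ

∑< : ℕ → (ℕ → ℕ) → ℕ
∑< zero    f = 0
∑< (suc k) f = f 0 + ∑< k (f ∘ suc)

syntax ∑< k (λ i → e) = ∑[ i < k ] e

∑-cong : ∀ k {f g : ℕ → ℕ} → (∀ i → i < k → f i ≡ g i) → ∑< k f ≡ ∑< k g
∑-cong zero    f≡g = refl
∑-cong (suc k) f≡g = cong₂ _+_ (f≡g 0 z<s) (∑-cong k (λ i i<k → f≡g (suc i) (s<s i<k)))

∑-snoc : ∀ k (f : ℕ → ℕ) → ∑< (suc k) f ≡ ∑< k f + f k
∑-snoc zero    f = +-comm (f 0) 0
∑-snoc (suc k) f = trans (cong (f 0 +_) (∑-snoc k (f ∘ suc))) (sym (+-assoc (f 0) _ _))

∑-+ : ∀ k (f g : ℕ → ℕ) → ∑[ i < k ] (f i + g i) ≡ ∑< k f + ∑< k g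
∑-+ zero    f g = refl
∑-+ (suc k) f g =
  trans (cong (f 0 + g 0 +_) (∑-+ k (f ∘ suc) (g ∘ suc))) (interchange (f 0) (g 0) _ _)
  where
    interchange : ∀ a b c d → (a + b) + (c + d) ≡ (a + c) + (b + d)
    interchange = solve-∀

∑-*ˡ : ∀ c k (f : ℕ → ℕ) → ∑[ i < k ] (c * f i) ≡ c * ∑< k f
∑-*ˡ c zero    f = sym (*-zeroʳ c)
∑-*ˡ c (suc k) f = trans (cong (c * f 0 +_) (∑-*ˡ c k (f ∘ suc))) (sym (*-distribˡ-+ c (f 0) _))

∑-const : ∀ k c → ∑[ i < k ] c ≡ k * c
∑-const zero    c = refl
∑-const (suc k) c = cong (c +_) (∑-const k c)

∑-zero : ∀ k → ∑[ i < k ] 0 ≡ 0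
∑-zero k = trans (∑-const k 0) (*-zeroʳ k)

∑-suc : ∀ k (f : ℕ → ℕ) → ∑[ i < k ] suc (f i) ≡ k + ∑< k f
∑-suc k f = trans (∑-+ k (λ _ → 1) f) (cong (_+ ∑< k f) (trans (∑-const k 1) (*-identityʳ k)))

∑-split : ∀ k l (f : ℕ → ℕ) → ∑< (k + l) f ≡ ∑< k f + ∑[ i < l ] f (k + i)
∑-split zero    l f = refl
∑-split (suc k) l f = trans (cong (f 0 +_) (∑-split k l (f ∘ suc))) (sym (+-assoc (f 0) _ _))

∑-parity : ∀ k (f : ℕ → ℕ) →
           ∑< (2 * k) f ≡ ∑[ j < k ] f (2 * j) + ∑[ j < k ] f (suc (2 * j))
∑-parity zero    f = refl
∑-parity (suc k) f = begin
    ∑< (2 * suc k) f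
  ≡⟨ cong (λ l → ∑< l f) (*-suc 2 k) ⟩
    f 0 + (f 1 + ∑< (2 * k) (f ∘ suc ∘ suc))
  ≡⟨ cong (λ s → f 0 + (f 1 + s)) (∑-parity k (f ∘ suc ∘ suc)) ⟩
    f 0 + (f 1 + (∑[ j < k ] f (2 + 2 * j) + ∑[ j < k ] f (3 + 2 * j)))
  ≡⟨ cong₂ (λ s t → f 0 + (f 1 + (s + t)))
       (∑-cong k (λ j _ → cong f (sym (*-suc 2 j))))
       (∑-cong k (λ j _ → cong (f ∘ suc) (sym (*-suc 2 j)))) ⟩
    f 0 + (f 1 + (∑[ j < k ] f (2 * suc j) + ∑[ j < k ] f (suc (2 * suc j))))
  ≡⟨ shuffle (f 0) (f 1) _ _ ⟩
    ∑[ j < suc k ] f (2 * j) + ∑[ j < suc k ] f (suc (2 * j)) ∎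
  where
    shuffle : ∀ a b c d → a + (b + (c + d)) ≡ a + c + (b + d)
    shuffle = solve-∀

∑-reverse : ∀ k (f : ℕ → ℕ) → ∑[ i < k ] f (k ∸ suc i) ≡ ∑< k f
∑-reverse zero    f = refl
∑-reverse (suc k) f = begin
    f k + ∑[ i < k ] f (k ∸ suc i) ≡⟨ cong (f k +_) (∑-reverse k f) ⟩
    f k + ∑< k f                  ≡⟨ +-comm (f k) _ ⟩
    ∑< k f + f k                  ≡⟨ ∑-snoc k f ⟨
    ∑< (suc k) f                  ∎

∑-triangle : ∀ k → 2 * ∑[ i < k ] suc i ≡ k * suc k
∑-triangle zero    = refl
∑-triangle (suc k) = begin
    2 * ∑[ i < suc k ] suc i         ≡⟨ cong (2 *_) (∑-snoc k suc) ⟩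
    2 * (∑[ i < k ] suc i + suc k)   ≡⟨ *-distribˡ-+ 2 (∑< k suc) (suc k) ⟩
    2 * ∑[ i < k ] suc i + 2 * suc k ≡⟨ cong (_+ 2 * suc k) (∑-triangle k) ⟩
    k * suc k + 2 * suc k            ≡⟨ step k ⟩
    suc k * suc (suc k)              ∎
  where
    step : ∀ k → k * suc k + 2 * suc k ≡ suc k * suc (suc k)
    step = solve-∀

-- Booleans and counting

T-injective : ∀ {a b} → T a ⇔ T b → a ≡ b
T-injective {false} {false} _   = refl
T-injective {false} {true}  a⇔b = ⊥-elim (from a⇔b tt)
T-injective {true}  {false} a⇔b = ⊥-elim (to a⇔b tt)
T-injective {true}  {true}  _   = refl

≡ᵇ-injective : ∀ (f : ℕ → ℕ) {a b} → (f a ≡ f b → a ≡ b) → (f a ≡ᵇ f b) ≡ (a ≡ᵇ b)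
≡ᵇ-injective f {a} {b} inj = T-injective (mk⇔ (≡⇒≡ᵇ a b ∘ inj ∘ ≡ᵇ⇒≡ (f a) (f b))
                                                 (≡⇒≡ᵇ (f a) (f b) ∘ cong f ∘ ≡ᵇ⇒≡ a b))

indicator : Bool → ℕ
indicator true  = 1
indicator false = 0

isOne : ℕ → ℕ
isOne d = indicator (d ≡ᵇ 1)

isOne-suc : ∀ {d} → d ≢ 0 → isOne (suc d) ≡ 0
isOne-suc {zero}  d≢0 = ⊥-elim (d≢0 refl)
isOne-suc {suc d} _   = refl

count : {A : Set} → (A → Bool) → List A → ℕ
count p xs = length (filter (T? ∘ p) xs)

module _ {A : Set} where
  count-∷ : ∀ (p : A → Bool) x xs → count p (x ∷ xs) ≡ indicator (p x) + count p xs
  count-∷ p x xs with p x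
  ... | true  = refl
  ... | false = refl

  count-cong : ∀ {p q : A → Bool} xs → (∀ x → p x ≡ q x) → count p xs ≡ count q xs
  count-cong         []       p≡q = refl
  count-cong {p} {q} (x ∷ xs) p≡q = begin
    count p (x ∷ xs)                   ≡⟨ count-∷ p x xs ⟩
    indicator (p x) + count p xs       ≡⟨ cong₂ _+_ (cong indicator (p≡q x)) (count-cong xs p≡q) ⟩
    indicator (q x) + count q xs       ≡⟨ count-∷ q x xs ⟨
    count q (x ∷ xs)                   ∎

  count≡sum : ∀ (p : A → Bool) xs → count p xs ≡ sum (map (indicator ∘ p) xs)
  count≡sum p []       = refl
  count≡sum p (x ∷ xs) = trans (count-∷ p x xs) (cong (indicator (p x) +_) (count≡sum p xs))

  any-cong : ∀ {p q : A → Bool} xs → (∀ x → p x ≡ q x) → any p xs ≡ any q xs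
  any-cong xs p≗q = cong or (map-cong p≗q xs)

  sum-map-cong : ∀ {f g : A → ℕ} xs → (∀ x → f x ≡ g x) → sum (map f xs) ≡ sum (map g xs)
  sum-map-cong xs f≡g = cong sum (map-cong f≡g xs)

  sum-map-++ : ∀ (f : A → ℕ) xs ys → sum (map f (xs ++ ys)) ≡ sum (map f xs) + sum (map f ys)
  sum-map-++ f xs ys = trans (cong sum (map-++ f xs ys)) (sum-++ (map f xs) (map f ys))

count-below : ∀ N s t (f : ℕ → ℕ) → (∀ i → f i ≡ s + i) → t ≤ s + N →
              count (λ k → not (t ≤ᵇ k)) (applyUpTo f N) ≡ t ∸ s
count-below zero    s t f f≗ t≤s+0 = sym (m≤n⇒m∸n≡0 (subst (t ≤_) (+-identityʳ s) t≤s+0))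
count-below (suc N) s t f f≗ t≤s+N = begin
    count below (applyUpTo f (suc N))
  ≡⟨ count-∷ below (f 0) _ ⟩
    indicator (below (f 0)) + count below (applyUpTo (f ∘ suc) N)
  ≡⟨ cong₂ (λ k c → indicator (below k) + c) (trans (f≗ 0) (+-identityʳ s))
       (count-below N (suc s) t (f ∘ suc) (λ i → trans (f≗ (suc i)) (+-suc s i))
                    (subst (t ≤_) (+-suc s N) t≤s+N)) ⟩
    indicator (below s) + (t ∸ suc s)
  ≡⟨ step t s ⟩
    t ∸ s ∎
  where
    below : ℕ → Bool
    below k = not (t ≤ᵇ k)
    step : ∀ t s → indicator (not (t ≤ᵇ s)) + (t ∸ suc s) ≡ t ∸ s
    step zero    zero    = refl
    step zero    (suc s) = refl
    step (suc t) zero    = refl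
    step (suc t) (suc s) = trans (cong (λ b → indicator (not b) + (t ∸ suc s)) (<ᵇ-suc t s)) (step t s)
      where
        <ᵇ-suc : ∀ t s → (t <ᵇ suc s) ≡ (t ≤ᵇ s)
        <ᵇ-suc zero    s = refl
        <ᵇ-suc (suc t) s = refl

-- The cycle 0 → 1 → ⋯ → m ∸ 1 → 0

next : ℕ → ℕ → ℕ
next m a = if suc a ≡ᵇ m then 0 else suc a

data NextView (m a : ℕ) : Set where
  wraps : suc a ≡ m → next m a ≡ 0       → NextView m a
  steps : suc a ≢ m → next m a ≡ suc a   → NextView m a

next-view : ∀ m a → NextView m a
next-view m a with suc a ≡ᵇ m in eq
... | true  = wraps (≡ᵇ⇒≡ (suc a) m (subst T (sym eq) tt)) (cong (λ b → if b then 0 else suc a) eq)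
... | false = steps (λ e → subst T eq (≡⇒≡ᵇ (suc a) m e)) (cong (λ b → if b then 0 else suc a) eq)

next-step : ∀ {m a} → suc a < m → next m a ≡ suc a
next-step {m} {a} sa<m with next-view m a
... | wraps sa≡m _ = ⊥-elim (<-irrefl sa≡m sa<m)
... | steps _ e    = e

next-wrap : ∀ {m a} → suc a ≡ m → next m a ≡ 0
next-wrap {m} {a} sa≡m with next-view m a
... | wraps _ e    = e
... | steps sa≢m _ = ⊥-elim (sa≢m sa≡m)

next-< : ∀ {m a} → a < m → next m a < m
next-< {m} {a} a<m with next-view m a
... | wraps _ e    = subst (_< m) (sym e) (≤-trans z<s a<m)
... | steps sa≢m e = subst (_< m) (sym e) (≤∧≢⇒< a<m sa≢m)

next-injective : ∀ {m a b} → a < m → b < m → next m a ≡ next m b → a ≡ b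
next-injective {m} {a} {b} _ _ e with next-view m a | next-view m b
... | wraps sa≡m _  | wraps sb≡m _  = suc-injective (trans sa≡m (sym sb≡m))
... | wraps _ ea    | steps _ eb    = ⊥-elim (0≢1+n (trans (sym ea) (trans e eb)))
... | steps _ ea    | wraps _ eb    = ⊥-elim (0≢1+n (trans (sym eb) (trans (sym e) ea)))
... | steps _ ea    | steps _ eb    = suc-injective (trans (sym ea) (trans e eb))

prev : ℕ → ℕ → ℕ
prev m zero    = m ∸ 1
prev m (suc a) = a

prev-< : ∀ {m a} → a < m → prev m a < m
prev-< {suc m} {zero}  _   = ≤-refl
prev-< {m}     {suc a} a<m = <-trans (n<1+n a) a<m

next-prev : ∀ {m a} → a < m → next m (prev m a) ≡ a
next-prev {suc m} {zero}  _   = next-wrap refl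
next-prev {m}     {suc a} a<m = next-step a<m

prev-next : ∀ {m a} → a < m → prev m (next m a) ≡ a
prev-next {m} {a} a<m with next-view m a
... | wraps sa≡m e = trans (cong (prev m) e) (cong (_∸ 1) (sym sa≡m))
... | steps _ e    = cong (prev m) e

∑-next : ∀ m (h : ℕ → ℕ) → ∑[ i < m ] h (next m i) ≡ ∑< m h
∑-next zero    h = refl
∑-next (suc k) h = begin
    ∑[ i < suc k ] h (next (suc k) i)          ≡⟨ ∑-snoc k (h ∘ next (suc k)) ⟩
    ∑[ i < k ] h (next (suc k) i) + h (next (suc k) k)
      ≡⟨ cong₂ _+_ (∑-cong k (λ i i<k → cong h (next-step (s<s i<k)))) (cong h (next-wrap refl)) ⟩
    ∑[ i < k ] h (suc i) + h 0                 ≡⟨ +-comm _ (h 0) ⟩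
    ∑< (suc k) h                               ∎

cyc-sym : ∀ m a b → cyc m a b ≡ cyc m b a
cyc-sym m a b =
  swap (suc a ≡ᵇ b) (suc b ≡ᵇ a) ((a ≡ᵇ 0) ∧ (b ≡ᵇ m ∸ 1)) ((b ≡ᵇ 0) ∧ (a ≡ᵇ m ∸ 1))
  where
    swap : ∀ p q r s → p ∨ (q ∨ (r ∨ s)) ≡ q ∨ (p ∨ (s ∨ r))
    swap true  true  _ _ = refl
    swap true  false _ _ = refl
    swap false true  _ _ = refl
    swap false false r s = ∨-comm r s

private
  ≡ᵇ⇒≡′ : ∀ {a b} → T (a ≡ᵇ b) → a ≡ b
  ≡ᵇ⇒≡′ {a} {b} = ≡ᵇ⇒≡ a b

  ≡⇒≡ᵇ′ : ∀ {a b} → a ≡ b → T (a ≡ᵇ b)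
  ≡⇒≡ᵇ′ {a} {b} = ≡⇒≡ᵇ a b

  wraps-to-0 : ∀ {m a b} → 0 < m → a ≡ 0 → b ≡ m ∸ 1 → next m b ≡ a
  wraps-to-0 {suc m} _ a≡0 b≡m = trans (next-wrap (cong suc b≡m)) (sym a≡0)

  steps-to : ∀ {m a b} → b < m → suc a ≡ b → next m a ≡ b
  steps-to b<m refl = next-step b<m

  next-cyc : ∀ {m a b} → next m a ≡ b → T (cyc m a b)
  next-cyc {m} {a} {b} e with next-view m a
  ... | wraps sa≡m ea = from (T-∨ {suc a ≡ᵇ b}) (inj₂ (from (T-∨ {suc b ≡ᵇ a}) (inj₂ (from T-∨ (inj₂
                          (from T-∧ (≡⇒≡ᵇ′ (trans (sym e) ea) , ≡⇒≡ᵇ′ (cong (_∸ 1) sa≡m))))))))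
  ... | steps _ ea    = from T-∨ (inj₁ (≡⇒≡ᵇ′ (trans (sym ea) e)))

cyc⇔next : ∀ {m a b} → a < m → b < m → T (cyc m a b) ⇔ (next m a ≡ b ⊎ next m b ≡ a)
cyc⇔next {m} {a} {b} a<m b<m = mk⇔ forward backward
  where
    forward : T (cyc m a b) → next m a ≡ b ⊎ next m b ≡ a
    forward t with to (T-∨ {suc a ≡ᵇ b}) t
    ... | inj₁ sa≡b = inj₁ (steps-to b<m (≡ᵇ⇒≡′ sa≡b))
    ... | inj₂ t₁ with to (T-∨ {suc b ≡ᵇ a}) t₁
    ... | inj₁ sb≡a = inj₂ (steps-to a<m (≡ᵇ⇒≡′ sb≡a))
    ... | inj₂ t₂ with to (T-∨ {(a ≡ᵇ 0) ∧ (b ≡ᵇ m ∸ 1)}) t₂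
    ... | inj₁ t₃ = let (a≡0 , b≡m) = to T-∧ t₃ in
                    inj₂ (wraps-to-0 {m} (≤-trans z<s a<m) (≡ᵇ⇒≡′ a≡0) (≡ᵇ⇒≡′ b≡m))
    ... | inj₂ t₃ = let (b≡0 , a≡m) = to T-∧ t₃ in
                    inj₁ (wraps-to-0 {m} (≤-trans z<s a<m) (≡ᵇ⇒≡′ b≡0) (≡ᵇ⇒≡′ a≡m))
    backward : next m a ≡ b ⊎ next m b ≡ a → T (cyc m a b)
    backward (inj₁ e) = next-cyc {m} e
    backward (inj₂ e) = subst T (cyc-sym m b a) (next-cyc {m} e)

cyc-next : ∀ {m a b} → a < m → b < m → cyc m (next m a) (next m b) ≡ cyc m a b
cyc-next {m} {a} {b} a<m b<m = T-injective (mk⇔ forward backward)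
  where
    forward : T (cyc m (next m a) (next m b)) → T (cyc m a b)
    forward t with to (cyc⇔next (next-< a<m) (next-< b<m)) t
    ... | inj₁ e = from (cyc⇔next a<m b<m) (inj₁ (next-injective (next-< a<m) b<m e))
    ... | inj₂ e = from (cyc⇔next a<m b<m) (inj₂ (next-injective (next-< b<m) a<m e))
    backward : T (cyc m a b) → T (cyc m (next m a) (next m b))
    backward t with to (cyc⇔next a<m b<m) t
    ... | inj₁ e = from (cyc⇔next (next-< a<m) (next-< b<m)) (inj₁ (cong (next m) e))
    ... | inj₂ e = from (cyc⇔next (next-< a<m) (next-< b<m)) (inj₂ (cong (next m) e))

cyc-prev : ∀ {m a b} → a < m → b < m → cyc m (prev m a) (prev m b) ≡ cyc m a b
cyc-prev {m} {a} {b} a<m b<m = begin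
  cyc m (prev m a) (prev m b)                      ≡⟨ cyc-next (prev-< a<m) (prev-< b<m) ⟨
  cyc m (next m (prev m a)) (next m (prev m b))    ≡⟨ cong₂ (cyc m) (next-prev a<m) (next-prev b<m) ⟩
  cyc m a b                                        ∎

next-no-fixed-point : ∀ {m a} → 2 ≤ m → next m a ≢ a
next-no-fixed-point {m} {a} 2≤m e with next-view m a
... | wraps sa≡m ea = <-irrefl (trans (cong suc (trans (sym ea) e)) sa≡m) 2≤m
... | steps _ ea    = 1+n≢n (trans (sym ea) e)

cyc-irreflexive : ∀ {m a} → 2 ≤ m → a < m → ¬ T (cyc m a a)
cyc-irreflexive 2≤m a<m t = [ no-loop , no-loop ] (to (cyc⇔next a<m a<m) t)
  where no-loop = next-no-fixed-point 2≤m

-- Arithmetic of positions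

toℕ-mod : ∀ {a k} .{{_ : NonZero k}} → a < k → toℕ (a mod k) ≡ a
toℕ-mod {a} {k} a<k = trans (toℕ-fromℕ< _) (m<n⇒m%n≡m a<k)

mod-toℕ : ∀ {k} .{{_ : NonZero k}} (i : Fin k) → toℕ i mod k ≡ i
mod-toℕ i = toℕ-injective (toℕ-mod (toℕ<n i))

rotate : ∀ {k} .{{_ : NonZero k}} → Fin k → Fin k
rotate {k} i = next k (toℕ i) mod k

unrotate : ∀ {k} .{{_ : NonZero k}} → Fin k → Fin k
unrotate {k} i = prev k (toℕ i) mod k

toℕ-rotate : ∀ {k} .{{_ : NonZero k}} (i : Fin k) → toℕ (rotate i) ≡ next k (toℕ i)
toℕ-rotate i = toℕ-mod (next-< (toℕ<n i))

rotate-unrotate : ∀ {k} .{{_ : NonZero k}} (i : Fin k) → rotate (unrotate i) ≡ i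
rotate-unrotate {k} i = toℕ-injective (begin
  toℕ (rotate (unrotate i))     ≡⟨ toℕ-rotate (unrotate i) ⟩
  next k (toℕ (unrotate i))     ≡⟨ cong (next k) (toℕ-mod (prev-< (toℕ<n i))) ⟩
  next k (prev k (toℕ i))       ≡⟨ next-prev (toℕ<n i) ⟩
  toℕ i                         ∎)

rotate-mod : ∀ {k a} .{{_ : NonZero k}} → a < k → rotate (a mod k) ≡ next k a mod k
rotate-mod {k} {a} a<k = toℕ-injective (begin
  toℕ (rotate (a mod k))   ≡⟨ toℕ-rotate (a mod k) ⟩
  next k (toℕ (a mod k))   ≡⟨ cong (next k) (toℕ-mod a<k) ⟩
  next k a                 ≡⟨ toℕ-mod (next-< a<k) ⟨
  toℕ (next k a mod k)     ∎)

sum-tabulate : ∀ {k} (h : Fin k → ℕ) (f : ℕ → ℕ) → (∀ i → h i ≡ f (toℕ i)) →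
               sum (tabulate h) ≡ ∑< k f
sum-tabulate {zero}  h f h≗f = refl
sum-tabulate {suc k} h f h≗f = cong₂ _+_ (h≗f Fin.zero) (sum-tabulate (h ∘ Fin.suc) (f ∘ suc) (h≗f ∘ Fin.suc))

sum-allFin : ∀ k .{{_ : NonZero k}} (h : Fin k → ℕ) → sum (map h (allFin k)) ≡ ∑[ i < k ] h (i mod k)
sum-allFin k h = trans (cong sum (map-tabulate (λ i → i) h))
                       (sum-tabulate h (λ i → h (i mod k)) (λ i → cong h (sym (mod-toℕ i))))

isEven-double : ∀ j → isEven (2 * j) ≡ true
isEven-double zero    = refl
isEven-double (suc j) = begin
  isEven (2 * suc j)    ≡⟨ cong isEven (*-suc 2 j) ⟩
  isEven (2 + 2 * j)    ≡⟨ not-involutive (isEven (2 * j)) ⟩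
  isEven (2 * j)        ≡⟨ isEven-double j ⟩
  true                  ∎

double-mono-< : ∀ {j k} → j < k → suc (2 * j) < 2 * k
double-mono-< {j} {k} j<k = subst (_≤ 2 * k) (*-suc 2 j) (*-monoʳ-≤ 2 j<k)

m∸n≡suc[m∸[1+n]] : ∀ {k a} → a < k → k ∸ a ≡ suc (k ∸ suc a)
m∸n≡suc[m∸[1+n]] {suc k} {zero}  _         = refl
m∸n≡suc[m∸[1+n]] {suc k} {suc a} (s≤s a<k) = m∸n≡suc[m∸[1+n]] a<k

Near : ℕ → ℕ → Set
Near x y = x ≤ suc y × y ≤ suc x

Near-suc : ∀ x → Near x (suc x)
Near-suc x = m≤n+m x 2 , ≤-refl

Near-sym : ∀ {x y} → Near x y → Near y x
Near-sym (x≤1+y , y≤1+x) = y≤1+x , x≤1+y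

⊔-lipschitz : ∀ {x y} → x ≤ suc y → 1 ⊔ x ≤ suc (1 ⊔ y)
⊔-lipschitz {x} {y} x≤sy = ⊔-lub (s≤s z≤n) (≤-trans x≤sy (s≤s (m≤n⊔m 1 y)))

1⊔≢0 : ∀ d → 1 ⊔ d ≢ 0
1⊔≢0 zero    ()
1⊔≢0 (suc d) ()

-- Distances certified by labellings

∈-vertices : ∀ {n} (x : Vtx n) → x ∈ vertices n
∈-vertices {n} (u a)  = ∈-++⁺ˡ (∈-map⁺ u (∈-allFin a))
∈-vertices {n} (u' a) = ∈-++⁺ʳ (map u (allFin (2 * n))) (∈-++⁺ˡ (∈-map⁺ u' (∈-allFin a)))
∈-vertices {n} (w j)  =
  ∈-++⁺ʳ (map u (allFin (2 * n))) (∈-++⁺ʳ (map u' (allFin (2 * n))) (∈-map⁺ w (∈-allFin j)))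

any-vertices⁺ : ∀ {n} (p : Vtx n → Bool) x → T (p x) → T (any p (vertices n))
any-vertices⁺ p x px = any⁺ p (lose (∈-vertices x) px)

any-vertices⁻ : ∀ {n} (p : Vtx n → Bool) → T (any p (vertices n)) → ∃ λ x → T (p x)
any-vertices⁻ {n} p t = satisfied (any⁻ p (vertices n) t)

eqV-refl : ∀ {n} (x : Vtx n) → T (eqV x x)
eqV-refl (u a)  = ≡⇒≡ᵇ (toℕ a) (toℕ a) refl
eqV-refl (u' a) = ≡⇒≡ᵇ (toℕ a) (toℕ a) refl
eqV-refl (w j)  = ≡⇒≡ᵇ (toℕ j) (toℕ j) refl

eqV⇒≡ : ∀ {n} (x y : Vtx n) → T (eqV x y) → x ≡ y
eqV⇒≡ (u a)  (u b)  t = cong u  (toℕ-injective (≡ᵇ⇒≡ (toℕ a) (toℕ b) t))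
eqV⇒≡ (u' a) (u' b) t = cong u' (toℕ-injective (≡ᵇ⇒≡ (toℕ a) (toℕ b) t))
eqV⇒≡ (w i)  (w j)  t = cong w  (toℕ-injective (≡ᵇ⇒≡ (toℕ i) (toℕ j) t))

adj-irreflexive : ∀ {n} (x : Vtx n) → ¬ T (adj x x)
adj-irreflexive {suc n} (u a)  = cyc-irreflexive (*-monoʳ-≤ 2 (s≤s z≤n)) (toℕ<n a)
adj-irreflexive {suc n} (u' a) = cyc-irreflexive (*-monoʳ-≤ 2 (s≤s z≤n)) (toℕ<n a)
adj-irreflexive         (w j)  ()

record DistanceLabelling {n : ℕ} (x : Vtx n) : Set where
  field
    label     : Vtx n → ℕ
    zero-at   : ∀ y → eqV x y ≡ (label y ≡ᵇ 0)
    lipschitz : ∀ z y → T (adj z y) → label y ≤ suc (label z)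
    descent   : ∀ y k → label y ≡ suc k → ∃ λ z → T (adj z y) × label z ≡ k
    bounded   : ∀ y → label y ≤ order n

module _ {n : ℕ} {x : Vtx n} (L : DistanceLabelling x) where
  open DistanceLabelling L

  reach≡label≤ᵇ : ∀ k y → reach k x y ≡ (label y ≤ᵇ k)
  reach≡label≤ᵇ zero y = trans (zero-at y) (≡ᵇ0≡≤ᵇ0 (label y))
    where
      ≡ᵇ0≡≤ᵇ0 : ∀ d → (d ≡ᵇ 0) ≡ (d ≤ᵇ 0)
      ≡ᵇ0≡≤ᵇ0 zero    = refl
      ≡ᵇ0≡≤ᵇ0 (suc d) = refl
  reach≡label≤ᵇ (suc k) y = begin
      reach k x y ∨ any (λ z → reach k x z ∧ adj z y) (vertices n)
    ≡⟨ cong₂ _∨_ (reach≡label≤ᵇ k y)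
         (any-cong (vertices n) (λ z → cong (_∧ adj z y) (reach≡label≤ᵇ k z))) ⟩
      (label y ≤ᵇ k) ∨ any entersAtK (vertices n)
    ≡⟨ T-injective (mk⇔ forward backward) ⟩
      (label y ≤ᵇ suc k) ∎
    where
      entersAtK : Vtx n → Bool
      entersAtK z = (label z ≤ᵇ k) ∧ adj z y
      forward : T ((label y ≤ᵇ k) ∨ any entersAtK (vertices n)) → T (label y ≤ᵇ suc k)
      forward t with to (T-∨ {label y ≤ᵇ k}) t
      ... | inj₁ ly≤k = ≤⇒≤ᵇ (m≤n⇒m≤1+n (≤ᵇ⇒≤ (label y) k ly≤k))
      ... | inj₂ t′ with any-vertices⁻ entersAtK t′
      ... | z , t″ with to T-∧ t″
      ... | lz≤k , z~y =
            ≤⇒≤ᵇ {label y} {suc k} (≤-trans (lipschitz z y z~y) (s≤s (≤ᵇ⇒≤ (label z) k lz≤k)))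
      backward : T (label y ≤ᵇ suc k) → T ((label y ≤ᵇ k) ∨ any entersAtK (vertices n))
      backward t with m≤n⇒m<n∨m≡n (≤ᵇ⇒≤ (label y) (suc k) t)
      ... | inj₁ ly<sk = from T-∨ (inj₁ (≤⇒≤ᵇ (≤-pred ly<sk)))
      ... | inj₂ ly≡sk with descent y k ly≡sk
      ... | z , z~y , lz≡k = from (T-∨ {label y ≤ᵇ k})
              (inj₂ (any-vertices⁺ entersAtK z (from T-∧ (≤⇒≤ᵇ (≤-reflexive lz≡k) , z~y))))

  dist≡label : ∀ y → dist x y ≡ label y
  dist≡label y = begin
      count (λ k → not (reach k x y)) (upTo (order n))
    ≡⟨ count-cong (upTo (order n)) (λ k → cong not (reach≡label≤ᵇ k y)) ⟩
      count (λ k → not (label y ≤ᵇ k)) (upTo (order n))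
    ≡⟨ count-below (order n) 0 (label y) (λ i → i) (λ _ → refl) (bounded y) ⟩
      label y ∎

  label≡0⇒source : ∀ z → label z ≡ 0 → x ≡ z
  label≡0⇒source z lz≡0 = eqV⇒≡ x z (subst T (sym (trans (zero-at z) (cong (_≡ᵇ 0) lz≡0))) tt)

  adj≡label≡ᵇ1 : ∀ y → adj x y ≡ (label y ≡ᵇ 1)
  adj≡label≡ᵇ1 y = T-injective (mk⇔ forward backward)
    where
      label-source : label x ≡ 0
      label-source = ≡ᵇ⇒≡ (label x) 0 (subst T (zero-at x) (eqV-refl x))
      forward : T (adj x y) → T (label y ≡ᵇ 1)
      forward x~y with label y in ly
      ... | zero        = ⊥-elim (adj-irreflexive x (subst (T ∘ adj x) (sym (label≡0⇒source y ly)) x~y))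
      ... | suc zero    = tt
      ... | suc (suc k) = ⊥-elim (<-irrefl refl (≤-trans (s≤s (s≤s (z≤n {k})))
                             (subst₂ (λ a b → a ≤ suc b) ly label-source (lipschitz x y x~y))))
      backward : T (label y ≡ᵇ 1) → T (adj x y)
      backward ly≡1 with descent y 0 (≡ᵇ⇒≡ (label y) 1 ly≡1)
      ... | z , z~y , lz≡0 = subst (λ v → T (adj v y)) (sym (label≡0⇒source z lz≡0)) z~y

  deg≡count-label≡1 : deg x ≡ count (λ y → label y ≡ᵇ 1) (vertices n)
  deg≡count-label≡1 = count-cong (vertices n) adj≡label≡ᵇ1

-- Symmetries

record Symmetry (n : ℕ) : Set where
  field
    apply      : Vtx n → Vtx n
    surjective : ∀ y → ∃ λ x → apply x ≡ y
    eqV-apply  : ∀ x y → eqV (apply x) (apply y) ≡ eqV x y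
    adj-apply  : ∀ x y → adj (apply x) (apply y) ≡ adj x y
    sum-apply  : ∀ (F : Vtx n → ℕ) → sum (map F (vertices n)) ≡ sum (map (F ∘ apply) (vertices n))

module _ {n : ℕ} (φ : Symmetry n) where
  open Symmetry φ

  any-apply : ∀ (p : Vtx n → Bool) → any p (vertices n) ≡ any (p ∘ apply) (vertices n)
  any-apply p = T-injective (mk⇔ forward backward)
    where
      forward : T (any p (vertices n)) → T (any (p ∘ apply) (vertices n))
      forward t with any-vertices⁻ p t
      ... | y , py with surjective y
      ... | x , refl = any-vertices⁺ (p ∘ apply) x py
      backward : T (any (p ∘ apply) (vertices n)) → T (any p (vertices n))
      backward t with any-vertices⁻ (p ∘ apply) t
      ... | x , px = any-vertices⁺ p (apply x) px

  reach-apply : ∀ k x y → reach k (apply x) (apply y) ≡ reach k x y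
  reach-apply zero    x y = eqV-apply x y
  reach-apply (suc k) x y = cong₂ _∨_ (reach-apply k x y) (begin
      any (λ z → reach k (apply x) z ∧ adj z (apply y)) (vertices n)
    ≡⟨ any-apply (λ z → reach k (apply x) z ∧ adj z (apply y)) ⟩
      any (λ z → reach k (apply x) (apply z) ∧ adj (apply z) (apply y)) (vertices n)
    ≡⟨ any-cong (vertices n) (λ z → cong₂ _∧_ (reach-apply k x z) (adj-apply z y)) ⟩
      any (λ z → reach k x z ∧ adj z y) (vertices n) ∎)

  dist-apply : ∀ x y → dist (apply x) (apply y) ≡ dist x y
  dist-apply x y = count-cong (upTo (order n)) (λ k → cong not (reach-apply k x y))

  deg-apply : ∀ x → deg (apply x) ≡ deg x
  deg-apply x = begin
    count (adj (apply x)) (vertices n)                       ≡⟨ count≡sum (adj (apply x)) (vertices n) ⟩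
    sum (map (indicator ∘ adj (apply x)) (vertices n))       ≡⟨ sum-apply (indicator ∘ adj (apply x)) ⟩
    sum (map (indicator ∘ adj (apply x) ∘ apply) (vertices n)) ≡⟨ sum-map-cong (vertices n) (cong indicator ∘ adj-apply x) ⟩
    sum (map (indicator ∘ adj x) (vertices n))               ≡⟨ count≡sum (adj x) (vertices n) ⟨
    count (adj x) (vertices n)                               ∎

schultzTerm : ∀ {n} → Vtx n → ℕ
schultzTerm {n} x = sum (map (λ y → (deg x + deg y) * dist x y) (vertices n))

schultzTerm-apply : ∀ {n} (φ : Symmetry n) x → schultzTerm (Symmetry.apply φ x) ≡ schultzTerm x
schultzTerm-apply {n} φ x = begin
    sum (map (λ y → (deg (apply x) + deg y) * dist (apply x) y) (vertices n))
  ≡⟨ sum-apply (λ y → (deg (apply x) + deg y) * dist (apply x) y) ⟩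
    sum (map (λ y → (deg (apply x) + deg (apply y)) * dist (apply x) (apply y)) (vertices n))
  ≡⟨ sum-map-cong (vertices n)
       (λ y → cong₂ _*_ (cong₂ _+_ (deg-apply φ x) (deg-apply φ y)) (dist-apply φ x y)) ⟩
    sum (map (λ y → (deg x + deg y) * dist x y) (vertices n)) ∎
  where open Symmetry φ

-- The chain P_n for n = n₀ + 1

module Chain (n₀ : ℕ) where

  n m : ℕ
  n = suc n₀
  m = 2 * n

  m≡n+n : m ≡ n + n
  m≡n+n = cong (n +_) (+-identityʳ n)

  m∸n≡n : m ∸ n ≡ n
  m∸n≡n = trans (cong (_∸ n) m≡n+n) (m+n∸m≡n n n)

  1<m : 1 < m
  1<m = *-monoʳ-≤ 2 (s≤s (z≤n {n₀}))

  ringDist : ℕ → ℕ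
  ringDist b = b ⊓ (m ∸ b)

  ringDist-≤ : ∀ {b} → b ≤ n → ringDist b ≡ b
  ringDist-≤ {b} b≤n = m≤n⇒m⊓n≡m (≤-trans b≤n (subst (_≤ m ∸ b) m∸n≡n (∸-monoʳ-≤ m b≤n)))

  ringDist-≥ : ∀ {b} → n ≤ b → ringDist b ≡ m ∸ b
  ringDist-≥ {b} n≤b = m≥n⇒m⊓n≡n (≤-trans (subst (m ∸ b ≤_) m∸n≡n (∸-monoʳ-≤ m n≤b)) n≤b)

  ringDist≤n : ∀ b → ringDist b ≤ n
  ringDist≤n b with ≤-total b n
  ... | inj₁ b≤n = subst (_≤ n) (sym (ringDist-≤ b≤n)) b≤n
  ... | inj₂ n≤b = subst (_≤ n) (sym (ringDist-≥ n≤b)) (subst (m ∸ b ≤_) m∸n≡n (∸-monoʳ-≤ m n≤b))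

  ringDist≡0 : ∀ {b} → b < m → ringDist b ≡ 0 → b ≡ 0
  ringDist≡0 {b} b<m d≡0 with ≤-total b n
  ... | inj₁ b≤n = trans (sym (ringDist-≤ b≤n)) d≡0
  ... | inj₂ n≤b = ⊥-elim (<⇒≱ b<m (m∸n≡0⇒m≤n (trans (sym (ringDist-≥ n≤b)) d≡0)))

  ringDist-odd≢0 : ∀ j → j < n → ringDist (suc (2 * j)) ≢ 0
  ringDist-odd≢0 j j<n d≡0 = 1+n≢0 (ringDist≡0 (double-mono-< j<n) d≡0)

  ringDist-even≢0 : ∀ j → suc j < n → ringDist (2 * suc j) ≢ 0
  ringDist-even≢0 j sj<n d≡0 with ringDist≡0 (<-trans (n<1+n _) (double-mono-< sj<n)) d≡0
  ... | ()

  ringDist-suc : ∀ {a} → suc a < m → Near (ringDist (suc a)) (ringDist a)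
  ringDist-suc {a} sa<m with a <? n
  ... | yes a<n = subst₂ Near (sym (ringDist-≤ a<n)) (sym (ringDist-≤ (<⇒≤ a<n))) (Near-sym (Near-suc a))
  ... | no  a≮n = subst₂ Near (sym (ringDist-≥ (≤-trans n≤a (n≤1+n a))))
                    (sym (trans (ringDist-≥ n≤a) (m∸n≡suc[m∸[1+n]] (<-trans (n<1+n a) sa<m))))
                    (Near-suc (m ∸ suc a))
    where n≤a = ≮⇒≥ a≮n

  ringDist-next : ∀ {a} → a < m → Near (ringDist (next m a)) (ringDist a)
  ringDist-next {a} a<m with next-view m a
  ... | wraps sa≡m e rewrite e = z≤n , ≤-trans (m⊓n≤n a (m ∸ a)) (≤-reflexive m∸a≡1)
    where
      m∸a≡1 : m ∸ a ≡ 1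
      m∸a≡1 = trans (cong (_∸ a) (sym sa≡m)) (m+n∸n≡m 1 a)
  ... | steps sa≢m e rewrite e = ringDist-suc (≤∧≢⇒< a<m sa≢m)

  ringDist-adj : ∀ {a b} → a < m → b < m → T (cyc m a b) → ringDist b ≤ suc (ringDist a)
  ringDist-adj {a} {b} a<m b<m a~b with to (cyc⇔next a<m b<m) a~b
  ... | inj₁ refl = proj₁ (ringDist-next a<m)
  ... | inj₂ refl = proj₂ (ringDist-next b<m)

  ringDist-descent : ∀ {b k} → b < m → ringDist b ≡ suc k →
                     ∃ λ b′ → b′ < m × T (cyc m b′ b) × ringDist b′ ≡ k
  ringDist-descent {b} {k} b<m d≡sk with ≤-total b n
  ... | inj₁ b≤n = k , <-trans (n<1+n k) sk<m , from (cyc⇔next (<-trans (n<1+n k) sk<m) b<m) (inj₁ next-k≡b)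
                 , ringDist-≤ (≤-trans (n≤1+n k) (subst (_≤ n) b≡sk b≤n))
    where
      b≡sk : b ≡ suc k
      b≡sk = trans (sym (ringDist-≤ b≤n)) d≡sk
      sk<m : suc k < m
      sk<m = subst (_< m) b≡sk b<m
      next-k≡b : next m k ≡ b
      next-k≡b = trans (next-step sk<m) (sym b≡sk)
  ... | inj₂ n≤b = next m b , next-< b<m , from (cyc⇔next (next-< b<m) b<m) (inj₂ refl) , ringDist-next≡k
    where
      m∸b≡sk : m ∸ b ≡ suc k
      m∸b≡sk = trans (sym (ringDist-≥ n≤b)) d≡sk
      ringDist-next≡k : ringDist (next m b) ≡ k
      ringDist-next≡k with next-view m b
      ... | wraps sb≡m e = trans (cong ringDist e)
                             (suc-injective (trans (sym (m+n∸n≡m 1 b)) (trans (cong (_∸ b) sb≡m) m∸b≡sk)))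
      ... | steps sb≢m e = trans (cong ringDist e) (trans (ringDist-≥ (≤-trans n≤b (n≤1+n b)))
                             (suc-injective (trans (sym (m∸n≡suc[m∸[1+n]] b<m)) m∸b≡sk)))

  ringDist≡1 : ∀ {b} → b < m → ringDist b ≡ 1 → b ≡ 1 ⊎ suc b ≡ m
  ringDist≡1 {b} b<m d≡1 with ≤-total b n
  ... | inj₁ b≤n = inj₁ (trans (sym (ringDist-≤ b≤n)) d≡1)
  ... | inj₂ n≤b = inj₂ (trans (cong (_+ b) (sym (trans (sym (ringDist-≥ n≤b)) d≡1)))
                              (m∸n+n≡m (<⇒≤ b<m)))

  ringDist₁ : ℕ → ℕ
  ringDist₁ b = ringDist (prev m b)

  ringDist₁-adj : ∀ {a b} → a < m → b < m → T (cyc m a b) → ringDist₁ b ≤ suc (ringDist₁ a)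
  ringDist₁-adj a<m b<m a~b = ringDist-adj (prev-< a<m) (prev-< b<m) (subst T (sym (cyc-prev a<m b<m)) a~b)

  ringDist₁-descent : ∀ {b k} → b < m → ringDist₁ b ≡ suc k →
                      ∃ λ b′ → b′ < m × T (cyc m b′ b) × ringDist₁ b′ ≡ k
  ringDist₁-descent {b} b<m d≡sk with ringDist-descent (prev-< b<m) d≡sk
  ... | c , c<m , c~pb , dc≡k =
          next m c , next-< c<m , subst T cyc-eq c~pb , trans (cong ringDist (prev-next c<m)) dc≡k
    where
      cyc-eq : cyc m c (prev m b) ≡ cyc m (next m c) b
      cyc-eq = trans (sym (cyc-next c<m (prev-< b<m))) (cong (cyc m (next m c)) (next-prev b<m))

  ringDist₁≡0 : ∀ {b} → b < m → ringDist₁ b ≡ 0 → b ≡ 1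
  ringDist₁≡0 {b} b<m d≡0 = begin
    b                     ≡⟨ next-prev b<m ⟨
    next m (prev m b)     ≡⟨ cong (next m) (ringDist≡0 (prev-< b<m) d≡0) ⟩
    next m 0              ≡⟨ next-step {m} 1<m ⟩
    1                     ∎

  ∑-ringDist₁ : ∀ (g : ℕ → ℕ) → ∑[ b < m ] g (ringDist₁ b) ≡ ∑[ b < m ] g (ringDist b)
  ∑-ringDist₁ g = begin
    ∑[ b < m ] g (ringDist₁ b)             ≡⟨ ∑-next m (g ∘ ringDist₁) ⟨
    ∑[ b < m ] g (ringDist₁ (next m b))    ≡⟨ ∑-cong m (λ b b<m → cong (g ∘ ringDist) (prev-next b<m)) ⟩
    ∑[ b < m ] g (ringDist b)              ∎

  uAt u'At : ℕ → Vtx n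
  uAt  a = u  (a mod m)
  u'At a = u' (a mod m)

  wAt : ℕ → Vtx n
  wAt j = w (j mod n)

  sum-vertices : ∀ (F : Vtx n → ℕ) → sum (map F (vertices n))
                 ≡ ∑[ a < m ] F (uAt a) + (∑[ a < m ] F (u'At a) + ∑[ j < n ] F (wAt j))
  sum-vertices F = begin
      sum (map F (us ++ u's ++ ws))
    ≡⟨ sum-map-++ F us (u's ++ ws) ⟩
      sum (map F us) + sum (map F (u's ++ ws))
    ≡⟨ cong (sum (map F us) +_) (sum-map-++ F u's ws) ⟩
      sum (map F us) + (sum (map F u's) + sum (map F ws))
    ≡⟨ cong₂ (λ a b → a + (b + sum (map F ws))) (block u) (block u') ⟩
      ∑[ a < m ] F (uAt a) + (∑[ a < m ] F (u'At a) + sum (map F ws))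
    ≡⟨ cong (λ c → ∑[ a < m ] F (uAt a) + (∑[ a < m ] F (u'At a) + c))
         (trans (cong sum (sym (map-∘ (allFin n)))) (sum-allFin n (F ∘ w))) ⟩
      ∑[ a < m ] F (uAt a) + (∑[ a < m ] F (u'At a) + ∑[ j < n ] F (wAt j)) ∎
    where
      us u's ws : List (Vtx n)
      us  = map u  (allFin m)
      u's = map u' (allFin m)
      ws  = map w  (allFin n)
      block : (c : Fin m → Vtx n) → sum (map F (map c (allFin m))) ≡ ∑[ a < m ] F (c (a mod m))
      block c = trans (cong sum (sym (map-∘ (allFin m)))) (sum-allFin m (F ∘ c))

  ∑-index-u : ∀ (U : ℕ → ℕ) → ∑[ a < m ] U (toℕ (a mod m)) ≡ ∑< m U
  ∑-index-u U = ∑-cong m (λ a a<m → cong U (toℕ-mod a<m))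

  ∑-index-w : ∀ (W : ℕ → ℕ) → ∑[ j < n ] W (toℕ (j mod n)) ≡ ∑< n W
  ∑-index-w W = ∑-cong n (λ j j<n → cong W (toℕ-mod j<n))

  next² : ℕ → ℕ
  next² a = next m (next m a)

  next²-injective : ∀ {a b} → a < m → b < m → next² a ≡ next² b → a ≡ b
  next²-injective a<m b<m = next-injective a<m b<m ∘ next-injective (next-< a<m) (next-< b<m)

  isEven-next² : ∀ {a} → a < m → isEven (next² a) ≡ isEven a
  isEven-next² {a} a<m with next-view m a
  ... | wraps sa≡m e = begin
      isEven (next m (next m a))   ≡⟨ cong (isEven ∘ next m) e ⟩
      isEven (next m 0)            ≡⟨ cong isEven (next-step {m} 1<m) ⟩
      false                        ≡⟨ cong not (trans (cong isEven sa≡m) (isEven-double n)) ⟨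
      not (isEven (suc a))         ≡⟨ not-involutive (isEven a) ⟩
      isEven a                     ∎
  ... | steps sa≢m e with next-view m (suc a)
  ...   | wraps ssa≡m e′ = begin
      isEven (next m (next m a))   ≡⟨ cong (isEven ∘ next m) e ⟩
      isEven (next m (suc a))      ≡⟨ cong isEven e′ ⟩
      true                         ≡⟨ trans (cong isEven ssa≡m) (isEven-double n) ⟨
      isEven (2 + a)               ≡⟨ not-involutive (isEven a) ⟩
      isEven a                     ∎
  ...   | steps _ e′ = begin
      isEven (next m (next m a))   ≡⟨ cong (isEven ∘ next m) e ⟩
      isEven (next m (suc a))      ≡⟨ cong isEven e′ ⟩
      isEven (2 + a)               ≡⟨ not-involutive (isEven a) ⟩
      isEven a                     ∎

  next²-attachment : ∀ {j} → j < n → next² (suc (2 * j)) ≡ suc (2 * next n j)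
  next²-attachment {j} j<n with next-view n j
  ... | wraps sj≡n e = begin
      next m (next m (suc (2 * j)))   ≡⟨ cong (next m) (next-wrap (trans (sym (*-suc 2 j)) (cong (2 *_) sj≡n))) ⟩
      next m 0                        ≡⟨ next-step {m} 1<m ⟩
      1                               ≡⟨ cong (λ i → suc (2 * i)) e ⟨
      suc (2 * next n j)              ∎
  ... | steps sj≢n e = begin
      next m (next m (suc (2 * j)))   ≡⟨ cong (next m) (next-step (<-trans (n<1+n _) 2j+3<m)) ⟩
      next m (2 + 2 * j)              ≡⟨ next-step 2j+3<m ⟩
      suc (2 + 2 * j)                 ≡⟨ cong suc (trans (cong (2 *_) e) (*-suc 2 j)) ⟨
      suc (2 * next n j)              ∎
    where
      2j+3<m : 3 + 2 * j < m
      2j+3<m = subst (_< m) (cong suc (*-suc 2 j)) (double-mono-< (≤∧≢⇒< j<n sj≢n))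

  next²-step : ∀ {a} → 2 + a < m → next² a ≡ 2 + a
  next²-step 2+a<m = trans (cong (next m) (next-step (<-trans (n<1+n _) 2+a<m))) (next-step 2+a<m)

  rotate² : Fin m → Fin m
  rotate² = rotate ∘ rotate

  toℕ-rotate² : ∀ (a : Fin m) → toℕ (rotate² a) ≡ next² (toℕ a)
  toℕ-rotate² a = trans (toℕ-rotate (rotate a)) (cong (next m) (toℕ-rotate a))

  rotate²-unrotate² : ∀ (a : Fin m) → rotate² (unrotate (unrotate a)) ≡ a
  rotate²-unrotate² a = trans (cong rotate (rotate-unrotate (unrotate a))) (rotate-unrotate a)

  rotate²-mod : ∀ {a} → a < m → rotate² (a mod m) ≡ next² a mod m
  rotate²-mod a<m = trans (cong rotate (rotate-mod a<m)) (rotate-mod (next-< a<m))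

  ρ : Vtx n → Vtx n
  ρ (u a)  = u  (rotate² a)
  ρ (u' a) = u' (rotate² a)
  ρ (w j)  = w  (rotate j)

  private
    ≡ᵇ-rotate² : ∀ (a b : Fin m) → (toℕ (rotate² a) ≡ᵇ toℕ (rotate² b)) ≡ (toℕ a ≡ᵇ toℕ b)
    ≡ᵇ-rotate² a b = trans (cong₂ _≡ᵇ_ (toℕ-rotate² a) (toℕ-rotate² b))
                           (≡ᵇ-injective next² (next²-injective (toℕ<n a) (toℕ<n b)))

    ≡ᵇ-rotate : ∀ (i j : Fin n) → (toℕ (rotate i) ≡ᵇ toℕ (rotate j)) ≡ (toℕ i ≡ᵇ toℕ j)
    ≡ᵇ-rotate i j = trans (cong₂ _≡ᵇ_ (toℕ-rotate i) (toℕ-rotate j))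
                          (≡ᵇ-injective (next n) (next-injective (toℕ<n i) (toℕ<n j)))

    cyc-rotate² : ∀ (a b : Fin m) → cyc m (toℕ (rotate² a)) (toℕ (rotate² b)) ≡ cyc m (toℕ a) (toℕ b)
    cyc-rotate² a b = begin
      cyc m (toℕ (rotate² a)) (toℕ (rotate² b))   ≡⟨ cong₂ (cyc m) (toℕ-rotate² a) (toℕ-rotate² b) ⟩
      cyc m (next² (toℕ a)) (next² (toℕ b))       ≡⟨ cyc-next (next-< (toℕ<n a)) (next-< (toℕ<n b)) ⟩
      cyc m (next m (toℕ a)) (next m (toℕ b))     ≡⟨ cyc-next (toℕ<n a) (toℕ<n b) ⟩
      cyc m (toℕ a) (toℕ b)                       ∎

    rung-rotate² : ∀ (a b : Fin m) → (toℕ (rotate² a) ≡ᵇ toℕ (rotate² b)) ∧ isEven (toℕ (rotate² a))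
                                   ≡ (toℕ a ≡ᵇ toℕ b) ∧ isEven (toℕ a)
    rung-rotate² a b =
      cong₂ _∧_ (≡ᵇ-rotate² a b) (trans (cong isEven (toℕ-rotate² a)) (isEven-next² (toℕ<n a)))

    spoke-rotate : ∀ (a : Fin m) (j : Fin n) → (toℕ (rotate² a) ≡ᵇ suc (2 * toℕ (rotate j)))
                                            ≡ (toℕ a ≡ᵇ suc (2 * toℕ j))
    spoke-rotate a j = begin
        (toℕ (rotate² a) ≡ᵇ suc (2 * toℕ (rotate j)))
      ≡⟨ cong₂ _≡ᵇ_ (toℕ-rotate² a) (cong (λ i → suc (2 * i)) (toℕ-rotate j)) ⟩
        (next² (toℕ a) ≡ᵇ suc (2 * next n (toℕ j)))
      ≡⟨ cong (next² (toℕ a) ≡ᵇ_) (next²-attachment (toℕ<n j)) ⟨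
        (next² (toℕ a) ≡ᵇ next² (suc (2 * toℕ j)))
      ≡⟨ ≡ᵇ-injective next² (next²-injective (toℕ<n a) (double-mono-< (toℕ<n j))) ⟩
        (toℕ a ≡ᵇ suc (2 * toℕ j)) ∎

  eqV-ρ : ∀ x y → eqV (ρ x) (ρ y) ≡ eqV x y
  eqV-ρ (u a)  (u b)  = ≡ᵇ-rotate² a b
  eqV-ρ (u a)  (u' b) = refl
  eqV-ρ (u a)  (w j)  = refl
  eqV-ρ (u' a) (u b)  = refl
  eqV-ρ (u' a) (u' b) = ≡ᵇ-rotate² a b
  eqV-ρ (u' a) (w j)  = refl
  eqV-ρ (w i)  (u b)  = refl
  eqV-ρ (w i)  (u' b) = refl
  eqV-ρ (w i)  (w j)  = ≡ᵇ-rotate i j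

  adj-ρ : ∀ x y → adj (ρ x) (ρ y) ≡ adj x y
  adj-ρ (u a)  (u b)  = cyc-rotate² a b
  adj-ρ (u a)  (u' b) = rung-rotate² a b
  adj-ρ (u a)  (w j)  = spoke-rotate a j
  adj-ρ (u' a) (u b)  = rung-rotate² a b
  adj-ρ (u' a) (u' b) = cyc-rotate² a b
  adj-ρ (u' a) (w j)  = spoke-rotate a j
  adj-ρ (w j)  (u b)  = spoke-rotate b j
  adj-ρ (w j)  (u' b) = spoke-rotate b j
  adj-ρ (w i)  (w j)  = refl

  ρ-surjective : ∀ y → ∃ λ x → ρ x ≡ y
  ρ-surjective (u a)  = u  (unrotate (unrotate a)) , cong u  (rotate²-unrotate² a)
  ρ-surjective (u' a) = u' (unrotate (unrotate a)) , cong u' (rotate²-unrotate² a)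
  ρ-surjective (w j)  = w  (unrotate j) , cong w (rotate-unrotate j)

  sum-ρ : ∀ (F : Vtx n → ℕ) → sum (map F (vertices n)) ≡ sum (map (F ∘ ρ) (vertices n))
  sum-ρ F = begin
      sum (map F (vertices n))
    ≡⟨ sum-vertices F ⟩
      ∑[ a < m ] F (uAt a) + (∑[ a < m ] F (u'At a) + ∑[ j < n ] F (wAt j))
    ≡⟨ cong₂ _+_ (ring (F ∘ u)) (cong₂ _+_ (ring (F ∘ u')) spokes) ⟨
      ∑[ a < m ] F (ρ (uAt a)) + (∑[ a < m ] F (ρ (u'At a)) + ∑[ j < n ] F (ρ (wAt j)))
    ≡⟨ sum-vertices (F ∘ ρ) ⟨
      sum (map (F ∘ ρ) (vertices n)) ∎
    where
      ring : ∀ (G : Fin m → ℕ) → ∑[ a < m ] G (rotate² (a mod m)) ≡ ∑[ a < m ] G (a mod m)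
      ring G = begin
        ∑[ a < m ] G (rotate² (a mod m))   ≡⟨ ∑-cong m (λ a a<m → cong G (rotate²-mod a<m)) ⟩
        ∑[ a < m ] G (next² a mod m)       ≡⟨ ∑-next m (λ a → G (next m a mod m)) ⟩
        ∑[ a < m ] G (next m a mod m)      ≡⟨ ∑-next m (λ a → G (a mod m)) ⟩
        ∑[ a < m ] G (a mod m)             ∎
      spokes : ∑[ j < n ] F (ρ (wAt j)) ≡ ∑[ j < n ] F (wAt j)
      spokes = trans (∑-cong n (λ j j<n → cong (F ∘ w) (rotate-mod j<n))) (∑-next n (F ∘ wAt))

  rotation : Symmetry n
  rotation = record
    { apply = ρ ; surjective = ρ-surjective ; eqV-apply = eqV-ρ ; adj-apply = adj-ρ ; sum-apply = sum-ρ }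

  ρ-uAt : ∀ {a} → 2 + a < m → ρ (uAt a) ≡ uAt (2 + a)
  ρ-uAt 2+a<m = cong u (trans (rotate²-mod (<-trans (n<1+n _) (<-trans (n<1+n _) 2+a<m)))
                              (cong (_mod m) (next²-step 2+a<m)))

  ρ-wAt : ∀ {j} → suc j < n → ρ (wAt j) ≡ wAt (suc j)
  ρ-wAt sj<n = cong w (trans (rotate-mod (<-trans (n<1+n _) sj<n)) (cong (_mod n) (next-step sj<n)))

  σ : Vtx n → Vtx n
  σ (u a)  = u' a
  σ (u' a) = u a
  σ (w j)  = w j

  reflection : Symmetry n
  reflection = record
    { apply      = σ
    ; surjective = λ y → σ y , σ-involutive y
    ; eqV-apply  = eqV-σ
    ; adj-apply  = adj-σ
    ; sum-apply  = sum-σ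
    }
    where
      σ-involutive : ∀ y → σ (σ y) ≡ y
      σ-involutive (u a)  = refl
      σ-involutive (u' a) = refl
      σ-involutive (w j)  = refl
      eqV-σ : ∀ x y → eqV (σ x) (σ y) ≡ eqV x y
      eqV-σ (u a)  (u b)  = refl
      eqV-σ (u a)  (u' b) = refl
      eqV-σ (u a)  (w j)  = refl
      eqV-σ (u' a) (u b)  = refl
      eqV-σ (u' a) (u' b) = refl
      eqV-σ (u' a) (w j)  = refl
      eqV-σ (w i)  (u b)  = refl
      eqV-σ (w i)  (u' b) = refl
      eqV-σ (w i)  (w j)  = refl
      adj-σ : ∀ x y → adj (σ x) (σ y) ≡ adj x y
      adj-σ (u a)  (u b)  = refl
      adj-σ (u a)  (u' b) = refl
      adj-σ (u a)  (w j)  = refl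
      adj-σ (u' a) (u b)  = refl
      adj-σ (u' a) (u' b) = refl
      adj-σ (u' a) (w j)  = refl
      adj-σ (w i)  (u b)  = refl
      adj-σ (w i)  (u' b) = refl
      adj-σ (w i)  (w j)  = refl
      sum-σ : ∀ (F : Vtx n → ℕ) → sum (map F (vertices n)) ≡ sum (map (F ∘ σ) (vertices n))
      sum-σ F = trans (sum-vertices F)
                      (trans (swap (∑[ a < m ] F (uAt a)) (∑[ a < m ] F (u'At a)) _) (sym (sum-vertices (F ∘ σ))))
        where
          swap : ∀ a b c → a + (b + c) ≡ b + (a + c)
          swap = solve-∀

  module _ (G : Vtx n → ℕ) (G-ρ : ∀ x → G (ρ x) ≡ G x) where
    orbit-u : ∀ a j → a + 2 * j < m → G (uAt (a + 2 * j)) ≡ G (uAt a)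
    orbit-u a zero    _   = cong (G ∘ uAt) (+-identityʳ a)
    orbit-u a (suc j) lt = begin
      G (uAt (a + 2 * suc j))     ≡⟨ cong (G ∘ uAt) (shift a j) ⟩
      G (uAt (2 + (a + 2 * j)))   ≡⟨ cong G (ρ-uAt lt′) ⟨
      G (ρ (uAt (a + 2 * j)))     ≡⟨ G-ρ _ ⟩
      G (uAt (a + 2 * j))         ≡⟨ orbit-u a j (≤-trans (s≤s (m≤n+m _ 2)) lt′) ⟩
      G (uAt a)                   ∎
      where
        shift : ∀ a j → a + 2 * suc j ≡ 2 + (a + 2 * j)
        shift = solve-∀
        lt′ : 2 + (a + 2 * j) < m
        lt′ = subst (_< m) (shift a j) lt

    orbit-w : ∀ j → j < n → G (wAt j) ≡ G (wAt 0)
    orbit-w zero    _    = refl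
    orbit-w (suc j) sj<n = trans (cong G (sym (ρ-wAt sj<n))) (trans (G-ρ _) (orbit-w j (<-trans (n<1+n j) sj<n)))

    ∑-orbits-u : ∑[ a < m ] G (uAt a) ≡ n * G (uAt 0) + n * G (uAt 1)
    ∑-orbits-u = begin
        ∑[ a < m ] G (uAt a)
      ≡⟨ ∑-parity n (G ∘ uAt) ⟩
        ∑[ j < n ] G (uAt (2 * j)) + ∑[ j < n ] G (uAt (suc (2 * j)))
      ≡⟨ cong₂ _+_ (∑-cong n (λ j j<n → orbit-u 0 j (<-trans (n<1+n _) (double-mono-< j<n))))
                   (∑-cong n (λ j j<n → orbit-u 1 j (double-mono-< j<n))) ⟩
        ∑[ j < n ] G (uAt 0) + ∑[ j < n ] G (uAt 1)
      ≡⟨ cong₂ _+_ (∑-const n (G (uAt 0))) (∑-const n (G (uAt 1))) ⟩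
        n * G (uAt 0) + n * G (uAt 1) ∎

    ∑-orbits-w : ∑[ j < n ] G (wAt j) ≡ n * G (wAt 0)
    ∑-orbits-w = trans (∑-cong n orbit-w) (∑-const n (G (wAt 0)))

  order≡ : order n ≡ m + (m + n)
  order≡ = begin
      length (us ++ u's ++ ws)                       ≡⟨ length-++ us ⟩
      length us + length (u's ++ ws)                 ≡⟨ cong (length us +_) (length-++ u's) ⟩
      length us + (length u's + length ws)           ≡⟨ cong₂ (λ a b → a + (b + length ws)) (length-allFin u) (length-allFin u') ⟩
      m + (m + length ws)                            ≡⟨ cong (λ c → m + (m + c)) (length-allFin w) ⟩
      m + (m + n)                                    ∎
    where
      us u's ws : List (Vtx n)
      us  = map u  (allFin m)
      u's = map u' (allFin m)
      ws  = map w  (allFin n)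
      length-allFin : ∀ {k} (c : Fin k → Vtx n) → length (map c (allFin k)) ≡ k
      length-allFin c = trans (length-map c (allFin _)) (length-tabulate (λ i → i))

  ≤order : ∀ {d} → d ≤ 2 + n → d ≤ order n
  ≤order {d} d≤2+n = subst (d ≤_) (sym order≡) (≤-trans d≤2+n (2+n≤ n₀))
    where
      2+n≤ : ∀ k → 3 + k ≤ 2 * suc k + (2 * suc k + suc k)
      2+n≤ k = subst (3 + k ≤_) (expand k) (m≤m+n (3 + k) (2 + 4 * k))
        where
          expand : ∀ k → 3 + k + (2 + 4 * k) ≡ 2 * suc k + (2 * suc k + suc k)
          expand = solve-∀

  deg-by-labelling : ∀ {x} (L : DistanceLabelling x) → let open DistanceLabelling L in
    deg x ≡ ∑[ a < m ] isOne (label (uAt a))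
            + (∑[ a < m ] isOne (label (u'At a)) + ∑[ j < n ] isOne (label (wAt j)))
  deg-by-labelling {x} L = begin
      deg x                                      ≡⟨ deg≡count-label≡1 L ⟩
      count (λ y → label y ≡ᵇ 1) (vertices n)    ≡⟨ count≡sum (λ y → label y ≡ᵇ 1) (vertices n) ⟩
      sum (map (isOne ∘ label) (vertices n))     ≡⟨ sum-vertices (isOne ∘ label) ⟩
      ∑[ a < m ] isOne (label (uAt a))
        + (∑[ a < m ] isOne (label (u'At a)) + ∑[ j < n ] isOne (label (wAt j))) ∎
    where open DistanceLabelling L

  rung⇒≡ : ∀ (a b : Fin m) → T ((toℕ a ≡ᵇ toℕ b) ∧ isEven (toℕ a)) → toℕ a ≡ toℕ b
  rung⇒≡ a b e = ≡ᵇ⇒≡ (toℕ a) (toℕ b) (proj₁ (to T-∧ e))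

  rung : ∀ (b : Fin m) → T (isEven (toℕ b)) → T ((toℕ b ≡ᵇ toℕ b) ∧ isEven (toℕ b))
  rung b even = from T-∧ (≡⇒≡ᵇ (toℕ b) (toℕ b) refl , even)

  spoke⇒≡ : ∀ (a : Fin m) (j : Fin n) → T (toℕ a ≡ᵇ suc (2 * toℕ j)) → toℕ a ≡ suc (2 * toℕ j)
  spoke⇒≡ a j = ≡ᵇ⇒≡ (toℕ a) (suc (2 * toℕ j))

  spoke : ∀ (j : Fin n) → T (adj (uAt (suc (2 * toℕ j))) (w j))
  spoke j = ≡⇒≡ᵇ _ _ (toℕ-mod (double-mono-< (toℕ<n j)))

  ring-uAt : ∀ {a} (b : Fin m) → a < m → T (cyc m a (toℕ b)) → T (adj (uAt a) (u b))
  ring-uAt b a<m = subst (λ c → T (cyc m c (toℕ b))) (sym (toℕ-mod a<m))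

  ring-u'At : ∀ {a} (b : Fin m) → a < m → T (cyc m a (toℕ b)) → T (adj (u'At a) (u' b))
  ring-u'At b a<m = subst (λ c → T (cyc m c (toℕ b))) (sym (toℕ-mod a<m))

  -- The paper's u₁, u₂, w₁ are uAt 0, uAt 1, wAt 0 (indices are 0-based).
  fromU₁ : Vtx n → ℕ
  fromU₁ (u b)  = ringDist (toℕ b)
  fromU₁ (u' b) = suc (ringDist (toℕ b))
  fromU₁ (w j)  = suc (ringDist (suc (2 * toℕ j)))

  fromU₁-zero-at : ∀ y → eqV (uAt 0) y ≡ (fromU₁ y ≡ᵇ 0)
  fromU₁-zero-at (u b)  = T-injective (mk⇔
    (λ 0≡b → ≡⇒≡ᵇ _ 0 (cong ringDist (sym (≡ᵇ⇒≡ 0 (toℕ b) 0≡b))))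
    (λ d≡0 → ≡⇒≡ᵇ 0 (toℕ b) (sym (ringDist≡0 (toℕ<n b) (≡ᵇ⇒≡ _ 0 d≡0)))))
  fromU₁-zero-at (u' b) = refl
  fromU₁-zero-at (w j)  = refl

  fromU₁-lipschitz : ∀ z y → T (adj z y) → fromU₁ y ≤ suc (fromU₁ z)
  fromU₁-lipschitz (u a)  (u b)  e = ringDist-adj (toℕ<n a) (toℕ<n b) e
  fromU₁-lipschitz (u a)  (u' b) e = s≤s (≤-reflexive (cong ringDist (sym (rung⇒≡ a b e))))
  fromU₁-lipschitz (u a)  (w j)  e = s≤s (≤-reflexive (cong ringDist (sym (spoke⇒≡ a j e))))
  fromU₁-lipschitz (u' a) (u b)  e = ≤-trans (≤-reflexive (cong ringDist (sym (rung⇒≡ a b e)))) (m≤n+m _ 2)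
  fromU₁-lipschitz (u' a) (u' b) e = s≤s (ringDist-adj (toℕ<n a) (toℕ<n b) e)
  fromU₁-lipschitz (u' a) (w j)  e =
    s≤s (≤-trans (≤-reflexive (cong ringDist (sym (spoke⇒≡ a j e)))) (n≤1+n _))
  fromU₁-lipschitz (w j)  (u a)  e = ≤-trans (≤-reflexive (cong ringDist (spoke⇒≡ a j e))) (m≤n+m _ 2)
  fromU₁-lipschitz (w j)  (u' a) e = s≤s (≤-trans (≤-reflexive (cong ringDist (spoke⇒≡ a j e))) (n≤1+n _))

  fromU₁-descent : ∀ y k → fromU₁ y ≡ suc k → ∃ λ z → T (adj z y) × fromU₁ z ≡ k
  fromU₁-descent (u b) k d≡sk with ringDist-descent (toℕ<n b) d≡sk
  ... | a , a<m , a~b , da≡k = uAt a , ring-uAt b a<m a~b , trans (cong ringDist (toℕ-mod a<m)) da≡k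
  fromU₁-descent (u' b) k d≡sk with isEven (toℕ b) in even
  ... | true  = u b , rung b (subst T (sym even) tt) , suc-injective d≡sk
  ... | false with ringDist (toℕ b) in db
  ...   | zero   = ⊥-elim (subst T (trans (sym (cong isEven (ringDist≡0 (toℕ<n b) db))) even) tt)
  ...   | suc k′ with ringDist-descent (toℕ<n b) db
  ...     | a , a<m , a~b , da≡k′ = u'At a , ring-u'At b a<m a~b
                                   , trans (cong (suc ∘ ringDist) (toℕ-mod a<m))
                                           (trans (cong suc da≡k′) (suc-injective d≡sk))
  fromU₁-descent (w j) k d≡sk = uAt (suc (2 * toℕ j)) , spoke j
                              , trans (cong ringDist (toℕ-mod (double-mono-< (toℕ<n j)))) (suc-injective d≡sk)

  fromU₁-bounded : ∀ y → fromU₁ y ≤ order n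
  fromU₁-bounded (u b)  = ≤order (≤-trans (ringDist≤n _) (m≤n+m n 2))
  fromU₁-bounded (u' b) = ≤order (s≤s (≤-trans (ringDist≤n _) (n≤1+n n)))
  fromU₁-bounded (w j)  = ≤order (s≤s (≤-trans (ringDist≤n _) (n≤1+n n)))

  labellingU₁ : DistanceLabelling (uAt 0)
  labellingU₁ = record
    { label = fromU₁ ; zero-at = fromU₁-zero-at ; lipschitz = fromU₁-lipschitz
    ; descent = fromU₁-descent ; bounded = fromU₁-bounded }

  ringDist₁≡1⇒even : ∀ {b} → b < m → ringDist₁ b ≡ 1 → isEven b ≡ true
  ringDist₁≡1⇒even {b} b<m d≡1 with ringDist≡1 (prev-< b<m) d≡1
  ... | inj₁ pb≡1 = subst (λ c → isEven c ≡ true) (trans (cong (next m) (sym pb≡1)) (next-prev b<m)) next-1-even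
    where
      next-1-even : isEven (next m 1) ≡ true
      next-1-even with next-view m 1
      ... | wraps _ e = cong isEven e
      ... | steps _ e = cong isEven e
  ... | inj₂ spb≡m = subst (λ c → isEven c ≡ true) (trans (sym (next-wrap spb≡m)) (next-prev b<m)) refl

  -- u′₂ is two steps from u₂ (through w₁), hence 1 ⊔ _.
  fromU₂ : Vtx n → ℕ
  fromU₂ (u b)  = ringDist₁ (toℕ b)
  fromU₂ (u' b) = suc (1 ⊔ ringDist₁ (toℕ b))
  fromU₂ (w j)  = suc (ringDist₁ (suc (2 * toℕ j)))

  fromU₂-zero-at : ∀ y → eqV (uAt 1) y ≡ (fromU₂ y ≡ᵇ 0)
  fromU₂-zero-at (u b)  = trans (cong (_≡ᵇ toℕ b) (toℕ-mod 1<m)) (T-injective (mk⇔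
    (λ 1≡b → ≡⇒≡ᵇ _ 0 (cong ringDist₁ (sym (≡ᵇ⇒≡ 1 (toℕ b) 1≡b))))
    (λ d≡0 → ≡⇒≡ᵇ 1 (toℕ b) (sym (ringDist₁≡0 (toℕ<n b) (≡ᵇ⇒≡ _ 0 d≡0))))))
  fromU₂-zero-at (u' b) = refl
  fromU₂-zero-at (w j)  = refl

  ringDist₁-even : ∀ (a : Fin m) → T (isEven (toℕ a)) → 1 ⊔ ringDist₁ (toℕ a) ≡ ringDist₁ (toℕ a)
  ringDist₁-even a even with ringDist₁ (toℕ a) in da
  ... | zero  = ⊥-elim (subst T (cong isEven (ringDist₁≡0 (toℕ<n a) da)) even)
  ... | suc _ = refl

  fromU₂-lipschitz : ∀ z y → T (adj z y) → fromU₂ y ≤ suc (fromU₂ z)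
  fromU₂-lipschitz (u a)  (u b)  e = ringDist₁-adj (toℕ<n a) (toℕ<n b) e
  fromU₂-lipschitz (u a)  (u' b) e = s≤s (≤-reflexive (trans (cong (λ c → 1 ⊔ ringDist₁ c) (sym (rung⇒≡ a b e)))
                                       (ringDist₁-even a (proj₂ (to T-∧ e)))))
  fromU₂-lipschitz (u a)  (w j)  e = s≤s (≤-reflexive (cong ringDist₁ (sym (spoke⇒≡ a j e))))
  fromU₂-lipschitz (u' a) (u b)  e = ≤-trans (≤-reflexive (cong ringDist₁ (sym (rung⇒≡ a b e))))
                                       (≤-trans (m≤n⊔m 1 _) (m≤n+m _ 2))
  fromU₂-lipschitz (u' a) (u' b) e = s≤s (⊔-lipschitz (ringDist₁-adj (toℕ<n a) (toℕ<n b) e))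
  fromU₂-lipschitz (u' a) (w j)  e = s≤s (≤-trans (≤-reflexive (cong ringDist₁ (sym (spoke⇒≡ a j e))))
                                       (≤-trans (m≤n⊔m 1 _) (n≤1+n _)))
  fromU₂-lipschitz (w j)  (u a)  e = ≤-trans (≤-reflexive (cong ringDist₁ (spoke⇒≡ a j e))) (m≤n+m _ 2)
  fromU₂-lipschitz (w j)  (u' a) e = s≤s (≤-trans (≤-reflexive (cong (λ c → 1 ⊔ ringDist₁ c) (spoke⇒≡ a j e)))
                                       (⊔-lub (s≤s z≤n) (n≤1+n _)))

  fromU₂-descent : ∀ y k → fromU₂ y ≡ suc k → ∃ λ z → T (adj z y) × fromU₂ z ≡ k
  fromU₂-descent (u b) k d≡sk with ringDist₁-descent (toℕ<n b) d≡sk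
  ... | a , a<m , a~b , da≡k = uAt a , ring-uAt b a<m a~b , trans (cong ringDist₁ (toℕ-mod a<m)) da≡k
  fromU₂-descent (u' b) k d≡sk with ringDist₁ (toℕ b) in db
  ... | zero        = wAt 0 , ≡⇒≡ᵇ (toℕ b) 1 (ringDist₁≡0 (toℕ<n b) db) , suc-injective d≡sk
  ... | suc zero    = u b , rung b (subst T (sym (ringDist₁≡1⇒even (toℕ<n b) db)) tt)
                      , trans db (suc-injective d≡sk)
  ... | suc (suc t) with ringDist₁-descent (toℕ<n b) db
  ...   | a , a<m , a~b , da≡st = u'At a , ring-u'At b a<m a~b
                                , trans (cong (λ c → suc (1 ⊔ ringDist₁ c)) (toℕ-mod a<m))
                                        (trans (cong (suc ∘ (1 ⊔_)) da≡st) (suc-injective d≡sk))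
  fromU₂-descent (w j) k d≡sk = uAt (suc (2 * toℕ j)) , spoke j
                              , trans (cong ringDist₁ (toℕ-mod (double-mono-< (toℕ<n j)))) (suc-injective d≡sk)

  fromU₂-bounded : ∀ y → fromU₂ y ≤ order n
  fromU₂-bounded (u b)  = ≤order (≤-trans (ringDist≤n _) (m≤n+m n 2))
  fromU₂-bounded (u' b) =
    ≤order (s≤s (⊔-lub (s≤s z≤n) (≤-trans (ringDist≤n (prev m (toℕ b))) (n≤1+n n))))
  fromU₂-bounded (w j)  = ≤order (s≤s (≤-trans (ringDist≤n _) (n≤1+n n)))

  labellingU₂ : DistanceLabelling (uAt 1)
  labellingU₂ = record
    { label = fromU₂ ; zero-at = fromU₂-zero-at ; lipschitz = fromU₂-lipschitz
    ; descent = fromU₂-descent ; bounded = fromU₂-bounded }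

  spokeDist : ℕ → ℕ
  spokeDist zero    = 0
  spokeDist (suc j) = 2 + ringDist₁ (suc (2 * suc j))

  fromW₁ : Vtx n → ℕ
  fromW₁ (u b)  = suc (ringDist₁ (toℕ b))
  fromW₁ (u' b) = suc (ringDist₁ (toℕ b))
  fromW₁ (w j)  = spokeDist (toℕ j)

  fromW₁-zero-at : ∀ y → eqV (wAt 0) y ≡ (fromW₁ y ≡ᵇ 0)
  fromW₁-zero-at (u b)  = refl
  fromW₁-zero-at (u' b) = refl
  fromW₁-zero-at (w j)  = zero-iff (toℕ j)
    where
      zero-iff : ∀ t → (0 ≡ᵇ t) ≡ (spokeDist t ≡ᵇ 0)
      zero-iff zero    = refl
      zero-iff (suc t) = refl

  spokeDist-near : ∀ {a} j → a ≡ suc (2 * j) → Near (spokeDist j) (suc (ringDist₁ a))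
  spokeDist-near zero    refl = z≤n , ≤-refl
  spokeDist-near (suc j) refl = ≤-refl , m≤n+m _ 2

  fromW₁-lipschitz : ∀ z y → T (adj z y) → fromW₁ y ≤ suc (fromW₁ z)
  fromW₁-lipschitz (u a)  (u b)  e = s≤s (ringDist₁-adj (toℕ<n a) (toℕ<n b) e)
  fromW₁-lipschitz (u a)  (u' b) e =
    s≤s (≤-trans (≤-reflexive (cong ringDist₁ (sym (rung⇒≡ a b e)))) (n≤1+n _))
  fromW₁-lipschitz (u a)  (w j)  e = proj₁ (spokeDist-near (toℕ j) (spoke⇒≡ a j e))
  fromW₁-lipschitz (u' a) (u b)  e =
    s≤s (≤-trans (≤-reflexive (cong ringDist₁ (sym (rung⇒≡ a b e)))) (n≤1+n _))
  fromW₁-lipschitz (u' a) (u' b) e = s≤s (ringDist₁-adj (toℕ<n a) (toℕ<n b) e)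
  fromW₁-lipschitz (u' a) (w j)  e = proj₁ (spokeDist-near (toℕ j) (spoke⇒≡ a j e))
  fromW₁-lipschitz (w j)  (u a)  e = proj₂ (spokeDist-near (toℕ j) (spoke⇒≡ a j e))
  fromW₁-lipschitz (w j)  (u' a) e = proj₂ (spokeDist-near (toℕ j) (spoke⇒≡ a j e))

  fromW₁-descent : ∀ y k → fromW₁ y ≡ suc k → ∃ λ z → T (adj z y) × fromW₁ z ≡ k
  fromW₁-descent (u b) k d≡sk with ringDist₁ (toℕ b) in db
  ... | zero  = wAt 0 , ≡⇒≡ᵇ (toℕ b) 1 (ringDist₁≡0 (toℕ<n b) db) , suc-injective d≡sk
  ... | suc t with ringDist₁-descent (toℕ<n b) db
  ...   | a , a<m , a~b , da≡t = uAt a , ring-uAt b a<m a~b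
                               , trans (cong (suc ∘ ringDist₁) (toℕ-mod a<m))
                                       (trans (cong suc da≡t) (suc-injective d≡sk))
  fromW₁-descent (u' b) k d≡sk with ringDist₁ (toℕ b) in db
  ... | zero  = wAt 0 , ≡⇒≡ᵇ (toℕ b) 1 (ringDist₁≡0 (toℕ<n b) db) , suc-injective d≡sk
  ... | suc t with ringDist₁-descent (toℕ<n b) db
  ...   | a , a<m , a~b , da≡t = u'At a , ring-u'At b a<m a~b
                               , trans (cong (suc ∘ ringDist₁) (toℕ-mod a<m))
                                       (trans (cong suc da≡t) (suc-injective d≡sk))
  fromW₁-descent (w j) k d≡sk with toℕ j in tj
  ... | suc i = uAt (suc (2 * toℕ j)) , spoke j
              , trans (cong (suc ∘ ringDist₁) (trans (toℕ-mod (double-mono-< (toℕ<n j)))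
                                                     (cong (λ c → suc (2 * c)) tj)))
                      (suc-injective d≡sk)

  fromW₁-bounded : ∀ y → fromW₁ y ≤ order n
  fromW₁-bounded (u b)  = ≤order (s≤s (≤-trans (ringDist≤n _) (n≤1+n n)))
  fromW₁-bounded (u' b) = ≤order (s≤s (≤-trans (ringDist≤n _) (n≤1+n n)))
  fromW₁-bounded (w j)  = ≤order (spokeDist≤ (toℕ j))
    where
      spokeDist≤ : ∀ t → spokeDist t ≤ 2 + n
      spokeDist≤ zero    = z≤n
      spokeDist≤ (suc t) = s≤s (s≤s (ringDist≤n _))

  labellingW₁ : DistanceLabelling (wAt 0)
  labellingW₁ = record
    { label = fromW₁ ; zero-at = fromW₁-zero-at ; lipschitz = fromW₁-lipschitz
    ; descent = fromW₁-descent ; bounded = fromW₁-bounded }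

  ∑-ringDist : ∀ (g : ℕ → ℕ) → ∑[ b < m ] g (ringDist b) ≡ g 0 + (g n + 2 * ∑[ t < n₀ ] g (suc t))
  ∑-ringDist g = begin
      ∑[ b < m ] g (ringDist b)
    ≡⟨ cong (λ k → ∑[ b < k ] g (ringDist b)) m≡n+n ⟩
      ∑[ b < n + n ] g (ringDist b)
    ≡⟨ ∑-split n n (g ∘ ringDist) ⟩
      ∑[ b < n ] g (ringDist b) + ∑[ i < n ] g (ringDist (n + i))
    ≡⟨ cong₂ _+_ (∑-cong n (λ b b<n → cong g (ringDist-≤ (<⇒≤ b<n))))
                 (cong₂ _+_ (cong g (trans (cong ringDist (+-identityʳ n)) (ringDist-≤ ≤-refl)))
                            (∑-cong n₀ (λ i i<n₀ → cong g (far-half i i<n₀)))) ⟩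
      ∑< n g + (g n + ∑[ i < n₀ ] g (suc (n₀ ∸ suc i)))
    ≡⟨ cong (λ s → ∑< n g + (g n + s)) (∑-reverse n₀ (g ∘ suc)) ⟩
      g 0 + ∑[ t < n₀ ] g (suc t) + (g n + ∑[ t < n₀ ] g (suc t))
    ≡⟨ shuffle (g 0) (∑[ t < n₀ ] g (suc t)) (g n) ⟩
      g 0 + (g n + 2 * ∑[ t < n₀ ] g (suc t)) ∎
    where
      shuffle : ∀ a b c → a + b + (c + b) ≡ a + (c + 2 * b)
      shuffle = solve-∀
      far-half : ∀ i → i < n₀ → ringDist (n + suc i) ≡ suc (n₀ ∸ suc i)
      far-half i i<n₀ = begin
        ringDist (n + suc i)        ≡⟨ ringDist-≥ (m≤m+n n (suc i)) ⟩
        m ∸ (n + suc i)             ≡⟨ cong (_∸ (n + suc i)) m≡n+n ⟩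
        (n + n) ∸ (n + suc i)       ≡⟨ [m+n]∸[m+o]≡n∸o n n (suc i) ⟩
        n ∸ suc i                   ≡⟨ m∸n≡suc[m∸[1+n]] i<n₀ ⟩
        suc (n₀ ∸ suc i)            ∎

  ringSum : ℕ
  ringSum = ∑[ b < m ] ringDist b

  ringSum≡n² : ringSum ≡ n * n
  ringSum≡n² = trans (∑-ringDist (λ d → d)) (trans (cong (n +_) (∑-triangle n₀)) (square n₀))
    where
      square : ∀ k → suc k + k * suc k ≡ suc k * suc k
      square = solve-∀

  ∑-1⊔ringDist : ∑[ b < m ] (1 ⊔ ringDist b) ≡ suc ringSum
  ∑-1⊔ringDist = trans (∑-ringDist (1 ⊔_)) (cong suc (sym (∑-ringDist (λ d → d))))

  ∑-isOne-suc-ringDist : ∑[ b < m ] isOne (suc (ringDist b)) ≡ 1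
  ∑-isOne-suc-ringDist = trans (∑-ringDist (isOne ∘ suc)) (cong (λ s → suc (2 * s)) (∑-zero n₀))

  evenSum oddSum : ℕ
  evenSum = ∑[ j < n ] ringDist (2 * j)
  oddSum  = ∑[ j < n ] ringDist (suc (2 * j))

  evenSum+oddSum : evenSum + oddSum ≡ n * n
  evenSum+oddSum = trans (sym (∑-parity n ringDist)) ringSum≡n²

  evenSum-split : ∀ p t → n ≡ p + t → t ≤ p → p ≤ suc t → evenSum + 2 * p ≡ p * suc p + t * suc t
  evenSum-split p t n≡p+t t≤p p≤1+t = begin
      ∑[ j < n ] ringDist (2 * j) + 2 * p
    ≡⟨ cong (λ k → ∑[ j < k ] ringDist (2 * j) + 2 * p) n≡p+t ⟩
      ∑[ j < p + t ] ringDist (2 * j) + 2 * p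
    ≡⟨ cong (_+ 2 * p) (∑-split p t (λ j → ringDist (2 * j))) ⟩
      ∑[ j < p ] ringDist (2 * j) + ∑[ i < t ] ringDist (2 * (p + i)) + 2 * p
    ≡⟨ cong₂ (λ a b → a + b + 2 * p) (∑-cong p near-half) (∑-cong t far-half) ⟩
      ∑[ j < p ] (2 * j) + ∑[ i < t ] (2 * suc (t ∸ suc i)) + 2 * p
    ≡⟨ cong₂ (λ a b → a + b + 2 * p) (∑-*ˡ 2 p (λ j → j))
                                      (trans (∑-*ˡ 2 t _) (cong (2 *_) (∑-reverse t suc))) ⟩
      2 * ∑[ j < p ] j + 2 * ∑[ i < t ] suc i + 2 * p
    ≡⟨ rearrange (∑[ j < p ] j) (∑[ i < t ] suc i) p ⟩
      2 * (p + ∑[ j < p ] j) + 2 * ∑[ i < t ] suc i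
    ≡⟨ cong (λ a → 2 * a + 2 * ∑[ i < t ] suc i) (∑-suc p (λ j → j)) ⟨
      2 * ∑[ j < p ] suc j + 2 * ∑[ i < t ] suc i
    ≡⟨ cong₂ _+_ (∑-triangle p) (∑-triangle t) ⟩
      p * suc p + t * suc t ∎
    where
      near-half : ∀ j → j < p → ringDist (2 * j) ≡ 2 * j
      near-half j j<p = ringDist-≤ (subst₂ _≤_ (sym (cong (j +_) (+-identityʳ j))) (sym n≡p+t)
                                      (+-mono-≤ (<⇒≤ j<p) (s≤s⁻¹ (≤-trans j<p p≤1+t))))
      rearrange : ∀ a b p → 2 * a + 2 * b + 2 * p ≡ 2 * (p + a) + 2 * b
      rearrange = solve-∀
      far-half : ∀ i → i < t → ringDist (2 * (p + i)) ≡ 2 * suc (t ∸ suc i)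
      far-half i i<t = begin
        ringDist (2 * (p + i))      ≡⟨ ringDist-≥ n≤2[p+i] ⟩
        2 * n ∸ 2 * (p + i)         ≡⟨ *-distribˡ-∸ 2 n (p + i) ⟨
        2 * (n ∸ (p + i))           ≡⟨ cong (λ k → 2 * (k ∸ (p + i))) n≡p+t ⟩
        2 * ((p + t) ∸ (p + i))     ≡⟨ cong (2 *_) ([m+n]∸[m+o]≡n∸o p t i) ⟩
        2 * (t ∸ i)                 ≡⟨ cong (2 *_) (m∸n≡suc[m∸[1+n]] i<t) ⟩
        2 * suc (t ∸ suc i)         ∎
        where
          n≤2[p+i] : n ≤ 2 * (p + i)
          n≤2[p+i] = ≤-trans (subst (_≤ p + p) (sym n≡p+t) (+-monoʳ-≤ p t≤p))
                             (subst (_≤ 2 * (p + i)) (cong (p +_) (+-identityʳ p)) (*-monoʳ-≤ 2 (m≤m+n p i)))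

  evenSum-even : ∀ t → n ≡ t + t → 2 * evenSum ≡ n * n
  evenSum-even t n≡t+t = begin
      2 * evenSum          ≡⟨ cong (2 *_) evenSum≡ ⟩
      2 * (2 * (t * t))    ≡⟨ square t ⟩
      (t + t) * (t + t)    ≡⟨ cong₂ _*_ n≡t+t n≡t+t ⟨
      n * n                ∎
    where
      square : ∀ t → 2 * (2 * (t * t)) ≡ (t + t) * (t + t)
      square = solve-∀
      split-value : ∀ t → t * suc t + t * suc t ≡ 2 * (t * t) + 2 * t
      split-value = solve-∀
      evenSum≡ : evenSum ≡ 2 * (t * t)
      evenSum≡ = +-cancelʳ-≡ (2 * t) evenSum (2 * (t * t))
                   (trans (evenSum-split t t n≡t+t ≤-refl (n≤1+n t)) (split-value t))

  evenSum-odd : ∀ t → n ≡ suc t + t → suc (2 * evenSum) ≡ n * n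
  evenSum-odd t n≡1+t+t = begin
      suc (2 * evenSum)              ≡⟨ cong (suc ∘ (2 *_)) evenSum≡ ⟩
      suc (2 * (2 * (t * t) + 2 * t))  ≡⟨ square t ⟩
      (suc t + t) * (suc t + t)      ≡⟨ cong₂ _*_ n≡1+t+t n≡1+t+t ⟨
      n * n                          ∎
    where
      square : ∀ t → suc (2 * (2 * (t * t) + 2 * t)) ≡ (suc t + t) * (suc t + t)
      square = solve-∀
      split-value : ∀ t → suc t * suc (suc t) + t * suc t ≡ 2 * (t * t) + 2 * t + 2 * suc t
      split-value = solve-∀
      evenSum≡ : evenSum ≡ 2 * (t * t) + 2 * t
      evenSum≡ = +-cancelʳ-≡ (2 * suc t) evenSum (2 * (t * t) + 2 * t)
                   (trans (evenSum-split (suc t) t n≡1+t+t (n≤1+n t) ≤-refl) (split-value t))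

-- The Schultz index of P_n for n = p + 2

module Schultz (p : ℕ) where
  open Chain (suc p) public

  ∑-isOne-ringDist : ∑[ b < m ] isOne (ringDist b) ≡ 2
  ∑-isOne-ringDist = trans (∑-ringDist isOne) (cong (λ s → 2 * suc s) (∑-zero p))

  deg-u₁ : deg (uAt 0) ≡ 3
  deg-u₁ = begin
      deg (uAt 0)
    ≡⟨ deg-by-labelling labellingU₁ ⟩
      ∑[ a < m ] isOne (ringDist (toℕ (a mod m))) + (∑[ a < m ] isOne (suc (ringDist (toℕ (a mod m))))
        + ∑[ j < n ] isOne (suc (ringDist (suc (2 * toℕ (j mod n))))))
    ≡⟨ cong₂ _+_ (∑-index-u (isOne ∘ ringDist)) (cong₂ _+_ (∑-index-u (isOne ∘ suc ∘ ringDist))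
         (trans (∑-index-w (λ j → isOne (suc (ringDist (suc (2 * j))))))
                (trans (∑-cong n (λ j j<n → isOne-suc (ringDist-odd≢0 j j<n))) (∑-zero n)))) ⟩
      ∑[ b < m ] isOne (ringDist b) + (∑[ b < m ] isOne (suc (ringDist b)) + 0)
    ≡⟨ cong₂ (λ a b → a + (b + 0)) ∑-isOne-ringDist ∑-isOne-suc-ringDist ⟩
      3 ∎

  deg-u₂ : deg (uAt 1) ≡ 3
  deg-u₂ = begin
      deg (uAt 1)
    ≡⟨ deg-by-labelling labellingU₂ ⟩
      ∑[ a < m ] isOne (ringDist₁ (toℕ (a mod m))) + (∑[ a < m ] isOne (suc (1 ⊔ ringDist₁ (toℕ (a mod m))))
        + ∑[ j < n ] isOne (suc (ringDist₁ (suc (2 * toℕ (j mod n))))))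
    ≡⟨ cong₂ _+_ (trans (∑-index-u (isOne ∘ ringDist₁)) (trans (∑-ringDist₁ isOne) ∑-isOne-ringDist))
         (cong₂ _+_ (trans (∑-cong m (λ a _ → isOne-suc (1⊔≢0 (ringDist₁ (toℕ (a mod m)))))) (∑-zero m))
                    (trans (∑-index-w (λ j → isOne (suc (ringDist (2 * j)))))
                           (cong suc (trans (∑-cong (suc p) (λ j j<n → isOne-suc (ringDist-even≢0 j (s≤s j<n))))
                                            (∑-zero (suc p)))))) ⟩
      3 ∎

  deg-w₁ : deg (wAt 0) ≡ 2
  deg-w₁ = begin
      deg (wAt 0)
    ≡⟨ deg-by-labelling labellingW₁ ⟩
      ∑[ a < m ] isOne (suc (ringDist₁ (toℕ (a mod m)))) + (∑[ a < m ] isOne (suc (ringDist₁ (toℕ (a mod m))))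
        + ∑[ j < n ] isOne (spokeDist (toℕ (j mod n))))
    ≡⟨ cong₂ _+_ ring-block (cong₂ _+_ ring-block
         (trans (∑-index-w (isOne ∘ spokeDist)) (trans (∑-cong n (λ j _ → isOne-spokeDist j)) (∑-zero n)))) ⟩
      2 ∎
    where
      ring-block : ∑[ a < m ] isOne (suc (ringDist₁ (toℕ (a mod m)))) ≡ 1
      ring-block = trans (∑-index-u (isOne ∘ suc ∘ ringDist₁))
                         (trans (∑-ringDist₁ (isOne ∘ suc)) ∑-isOne-suc-ringDist)
      isOne-spokeDist : ∀ j → isOne (spokeDist j) ≡ 0
      isOne-spokeDist zero    = refl
      isOne-spokeDist (suc j) = refl

  deg-uAt : ∀ a → a < m → deg (uAt a) ≡ 3
  deg-uAt a a<m = begin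
      deg (uAt a)                        ≡⟨ cong (deg ∘ uAt) a≡r+2q ⟩
      deg (uAt (a % 2 + 2 * (a / 2)))    ≡⟨ orbit-u deg (deg-apply rotation) (a % 2) (a / 2) (subst (_< m) a≡r+2q a<m) ⟩
      deg (uAt (a % 2))                  ≡⟨ deg-at-residue (a % 2) (m%n<n a 2) ⟩
      3                                  ∎
    where
      a≡r+2q : a ≡ a % 2 + 2 * (a / 2)
      a≡r+2q = trans (m≡m%n+[m/n]*n a 2) (cong (a % 2 +_) (*-comm (a / 2) 2))
      deg-at-residue : ∀ r → r < 2 → deg (uAt r) ≡ 3
      deg-at-residue 0 _ = deg-u₁
      deg-at-residue 1 _ = deg-u₂
      deg-at-residue (2+ _) (s≤s (s≤s ()))

  deg-u : ∀ (b : Fin m) → deg (u {n} b) ≡ 3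
  deg-u b = trans (cong (deg ∘ u {n}) (sym (mod-toℕ b))) (deg-uAt (toℕ b) (toℕ<n b))

  deg-u' : ∀ (b : Fin m) → deg (u' {n} b) ≡ 3
  deg-u' b = trans (deg-apply reflection (u {n} b)) (deg-u b)

  deg-w : ∀ (j : Fin n) → deg (w j) ≡ 2
  deg-w j = trans (cong (deg ∘ w {n}) (sym (mod-toℕ j)))
                  (trans (orbit-w deg (deg-apply rotation) (toℕ j) (toℕ<n j)) deg-w₁)

  schultzTerm-by-labelling : ∀ {x} (L : DistanceLabelling x) → let open DistanceLabelling L in
    schultzTerm x ≡ (deg x + 3) * ∑[ a < m ] label (uAt a)
                  + ((deg x + 3) * ∑[ a < m ] label (u'At a) + (deg x + 2) * ∑[ j < n ] label (wAt j))
  schultzTerm-by-labelling {x} L = begin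
      sum (map (λ y → (deg x + deg y) * dist x y) (vertices n))
    ≡⟨ sum-map-cong (vertices n) (λ y → cong ((deg x + deg y) *_) (dist≡label L y)) ⟩
      sum (map (λ y → (deg x + deg y) * label y) (vertices n))
    ≡⟨ sum-vertices (λ y → (deg x + deg y) * label y) ⟩
      ∑[ a < m ] ((deg x + deg (uAt a)) * label (uAt a))
        + (∑[ a < m ] ((deg x + deg (u'At a)) * label (u'At a)) + ∑[ j < n ] ((deg x + deg (wAt j)) * label (wAt j)))
    ≡⟨ cong₂ _+_ (block (deg x + 3) uAt (λ a → cong (deg x +_) (deg-u (a mod m))))
         (cong₂ _+_ (block (deg x + 3) u'At (λ a → cong (deg x +_) (deg-u' (a mod m))))
                    (trans (∑-cong n (λ j _ → cong (_* label (wAt j)) (cong (deg x +_) (deg-w (j mod n)))))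
                           (∑-*ˡ (deg x + 2) n (label ∘ wAt)))) ⟩
      (deg x + 3) * ∑[ a < m ] label (uAt a)
        + ((deg x + 3) * ∑[ a < m ] label (u'At a) + (deg x + 2) * ∑[ j < n ] label (wAt j)) ∎
    where
      open DistanceLabelling L
      block : ∀ c (v : ℕ → Vtx n) → (∀ a → deg x + deg (v a) ≡ c) →
              ∑[ a < m ] ((deg x + deg (v a)) * label (v a)) ≡ c * ∑[ a < m ] label (v a)
      block c v e = trans (∑-cong m (λ a _ → cong (_* label (v a)) (e a))) (∑-*ˡ c m (label ∘ v))

  schultzTerm-u₁ : schultzTerm (uAt 0) ≡ 6 * ringSum + (6 * (m + ringSum) + 5 * (n + oddSum))
  schultzTerm-u₁ = begin
      schultzTerm (uAt 0)
    ≡⟨ schultzTerm-by-labelling labellingU₁ ⟩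
      (deg (uAt 0) + 3) * ∑[ a < m ] ringDist (toℕ (a mod m))
        + ((deg (uAt 0) + 3) * ∑[ a < m ] suc (ringDist (toℕ (a mod m)))
           + (deg (uAt 0) + 2) * ∑[ j < n ] suc (ringDist (suc (2 * toℕ (j mod n)))))
    ≡⟨ cong₂ (λ d s → (d + 3) * s + ((d + 3) * ∑[ a < m ] suc (ringDist (toℕ (a mod m)))
                        + (d + 2) * ∑[ j < n ] suc (ringDist (suc (2 * toℕ (j mod n))))))
             deg-u₁ (∑-index-u ringDist) ⟩
      6 * ringSum + (6 * ∑[ a < m ] suc (ringDist (toℕ (a mod m)))
                     + 5 * ∑[ j < n ] suc (ringDist (suc (2 * toℕ (j mod n)))))
    ≡⟨ cong₂ (λ s t → 6 * ringSum + (6 * s + 5 * t))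
         (trans (∑-index-u (suc ∘ ringDist)) (∑-suc m ringDist))
         (trans (∑-index-w (λ j → suc (ringDist (suc (2 * j))))) (∑-suc n (λ j → ringDist (suc (2 * j))))) ⟩
      6 * ringSum + (6 * (m + ringSum) + 5 * (n + oddSum)) ∎

  schultzTerm-u₂ : schultzTerm (uAt 1) ≡ 6 * ringSum + (6 * (m + suc ringSum) + 5 * (n + evenSum))
  schultzTerm-u₂ = begin
      schultzTerm (uAt 1)
    ≡⟨ schultzTerm-by-labelling labellingU₂ ⟩
      (deg (uAt 1) + 3) * ∑[ a < m ] ringDist₁ (toℕ (a mod m))
        + ((deg (uAt 1) + 3) * ∑[ a < m ] suc (1 ⊔ ringDist₁ (toℕ (a mod m)))
           + (deg (uAt 1) + 2) * ∑[ j < n ] suc (ringDist₁ (suc (2 * toℕ (j mod n)))))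
    ≡⟨ cong (λ d → (d + 3) * ∑[ a < m ] ringDist₁ (toℕ (a mod m))
                    + ((d + 3) * ∑[ a < m ] suc (1 ⊔ ringDist₁ (toℕ (a mod m)))
                       + (d + 2) * ∑[ j < n ] suc (ringDist₁ (suc (2 * toℕ (j mod n)))))) deg-u₂ ⟩
      6 * ∑[ a < m ] ringDist₁ (toℕ (a mod m))
        + (6 * ∑[ a < m ] suc (1 ⊔ ringDist₁ (toℕ (a mod m)))
           + 5 * ∑[ j < n ] suc (ringDist₁ (suc (2 * toℕ (j mod n)))))
    ≡⟨ cong₂ (λ s t → 6 * s + t) (trans (∑-index-u ringDist₁) (∑-ringDist₁ (λ d → d)))
         (cong₂ (λ s t → 6 * s + 5 * t)
           (begin
              ∑[ a < m ] suc (1 ⊔ ringDist₁ (toℕ (a mod m)))   ≡⟨ ∑-index-u (λ b → suc (1 ⊔ ringDist₁ b)) ⟩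
              ∑[ b < m ] suc (1 ⊔ ringDist₁ b)                 ≡⟨ ∑-suc m (λ b → 1 ⊔ ringDist₁ b) ⟩
              m + ∑[ b < m ] (1 ⊔ ringDist₁ b)                 ≡⟨ cong (m +_) (trans (∑-ringDist₁ (1 ⊔_)) ∑-1⊔ringDist) ⟩
              m + suc ringSum                                  ∎)
           (trans (∑-index-w (λ j → suc (ringDist (2 * j)))) (∑-suc n (λ j → ringDist (2 * j))))) ⟩
      6 * ringSum + (6 * (m + suc ringSum) + 5 * (n + evenSum)) ∎

  schultzTerm-w₁ : schultzTerm (wAt 0) ≡ 5 * (m + ringSum) + (5 * (m + ringSum) + 4 * (suc p + (suc p + evenSum)))
  schultzTerm-w₁ = begin
      schultzTerm (wAt 0)
    ≡⟨ schultzTerm-by-labelling labellingW₁ ⟩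
      (deg (wAt 0) + 3) * ∑[ a < m ] suc (ringDist₁ (toℕ (a mod m)))
        + ((deg (wAt 0) + 3) * ∑[ a < m ] suc (ringDist₁ (toℕ (a mod m)))
           + (deg (wAt 0) + 2) * ∑[ j < n ] spokeDist (toℕ (j mod n)))
    ≡⟨ cong (λ d → (d + 3) * ∑[ a < m ] suc (ringDist₁ (toℕ (a mod m)))
                    + ((d + 3) * ∑[ a < m ] suc (ringDist₁ (toℕ (a mod m)))
                       + (d + 2) * ∑[ j < n ] spokeDist (toℕ (j mod n)))) deg-w₁ ⟩
      5 * ∑[ a < m ] suc (ringDist₁ (toℕ (a mod m)))
        + (5 * ∑[ a < m ] suc (ringDist₁ (toℕ (a mod m))) + 4 * ∑[ j < n ] spokeDist (toℕ (j mod n)))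
    ≡⟨ cong₂ (λ s t → 5 * s + (5 * s + 4 * t)) ring-block spoke-block ⟩
      5 * (m + ringSum) + (5 * (m + ringSum) + 4 * (suc p + (suc p + evenSum))) ∎
    where
      ring-block : ∑[ a < m ] suc (ringDist₁ (toℕ (a mod m))) ≡ m + ringSum
      ring-block = trans (∑-index-u (suc ∘ ringDist₁))
                         (trans (∑-suc m ringDist₁) (cong (m +_) (∑-ringDist₁ (λ d → d))))
      -- evenSum unfolds to its terms with j ≥ 1, as ringDist 0 = 0.
      spoke-block : ∑[ j < n ] spokeDist (toℕ (j mod n)) ≡ suc p + (suc p + evenSum)
      spoke-block = begin
        ∑[ j < n ] spokeDist (toℕ (j mod n))                 ≡⟨ ∑-index-w spokeDist ⟩
        ∑[ j < suc p ] (2 + ringDist (2 * suc j))            ≡⟨ ∑-suc (suc p) (λ j → suc (ringDist (2 * suc j))) ⟩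
        suc p + ∑[ j < suc p ] suc (ringDist (2 * suc j))    ≡⟨ cong (suc p +_) (∑-suc (suc p) (λ j → ringDist (2 * suc j))) ⟩
        suc p + (suc p + evenSum)                            ∎

  schultzDoubleSum-orbits : schultzDoubleSum n ≡ n * schultzTerm (uAt 0) + n * schultzTerm (uAt 1)
      + (n * schultzTerm (uAt 0) + n * schultzTerm (uAt 1) + n * schultzTerm (wAt 0))
  schultzDoubleSum-orbits = begin
      sum (map schultzTerm (vertices n))
    ≡⟨ sum-vertices schultzTerm ⟩
      ∑[ a < m ] schultzTerm (uAt a) + (∑[ a < m ] schultzTerm (u'At a) + ∑[ j < n ] schultzTerm (wAt j))
    ≡⟨ cong (λ s → ∑[ a < m ] schultzTerm (uAt a) + (s + ∑[ j < n ] schultzTerm (wAt j)))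
            (∑-cong m (λ a _ → schultzTerm-apply reflection (uAt a))) ⟩
      ∑[ a < m ] schultzTerm (uAt a) + (∑[ a < m ] schultzTerm (uAt a) + ∑[ j < n ] schultzTerm (wAt j))
    ≡⟨ cong₂ (λ s t → s + (s + t)) (∑-orbits-u schultzTerm (schultzTerm-apply rotation))
                                   (∑-orbits-w schultzTerm (schultzTerm-apply rotation)) ⟩
      n * schultzTerm (uAt 0) + n * schultzTerm (uAt 1)
        + (n * schultzTerm (uAt 0) + n * schultzTerm (uAt 1) + n * schultzTerm (wAt 0)) ∎

  schultzDoubleSum-closed : schultzDoubleSum n ≡ 2 * (34 * n ^ 3 + 48 * n ^ 2 + 2 * n + n * (2 * evenSum))
  schultzDoubleSum-closed = begin
      schultzDoubleSum n
    ≡⟨ schultzDoubleSum-orbits ⟩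
      n * schultzTerm (uAt 0) + n * schultzTerm (uAt 1)
        + (n * schultzTerm (uAt 0) + n * schultzTerm (uAt 1) + n * schultzTerm (wAt 0))
    ≡⟨ cong₂ (λ s t → s + (s + t)) (cong₂ (λ a b → n * a + n * b) schultzTerm-u₁ schultzTerm-u₂)
                                   (cong (n *_) schultzTerm-w₁) ⟩
      n * T₁ + n * T₂ + (n * T₁ + n * T₂ + n * Tw)
    ≡⟨ collect p ringSum evenSum oddSum ⟩
      58 * n * ringSum + 96 * n * n + 4 * n + 4 * n * evenSum + 10 * n * (evenSum + oddSum)
    ≡⟨ cong₂ (λ a b → 58 * n * a + 96 * n * n + 4 * n + 4 * n * evenSum + 10 * n * b)
             ringSum≡n² evenSum+oddSum ⟩
      58 * n * (n * n) + 96 * n * n + 4 * n + 4 * n * evenSum + 10 * n * (n * n)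
    ≡⟨ simplify p evenSum ⟩
      2 * (34 * n ^ 3 + 48 * n ^ 2 + 2 * n + n * (2 * evenSum)) ∎
    where
      T₁ T₂ Tw : ℕ
      T₁ = 6 * ringSum + (6 * (m + ringSum) + 5 * (n + oddSum))
      T₂ = 6 * ringSum + (6 * (m + suc ringSum) + 5 * (n + evenSum))
      Tw = 5 * (m + ringSum) + (5 * (m + ringSum) + 4 * (suc p + (suc p + evenSum)))
      collect : ∀ p A E O → let n = 2 + p; m = 2 * n in
          n * (6 * A + (6 * (m + A) + 5 * (n + O))) + n * (6 * A + (6 * (m + suc A) + 5 * (n + E)))
          + (n * (6 * A + (6 * (m + A) + 5 * (n + O))) + n * (6 * A + (6 * (m + suc A) + 5 * (n + E)))
             + n * (5 * (m + A) + (5 * (m + A) + 4 * (suc p + (suc p + E)))))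
          ≡ 58 * n * A + 96 * n * n + 4 * n + 4 * n * E + 10 * n * (E + O)
      collect = solve-∀
      simplify : ∀ p E → let n = 2 + p in
          58 * n * (n * n) + 96 * n * n + 4 * n + 4 * n * E + 10 * n * (n * n)
          ≡ 2 * (34 * (n * (n * (n * 1))) + 48 * (n * (n * 1)) + 2 * n + n * (2 * E))
      simplify = solve-∀

  Sc≡ : Sc n ≡ 34 * n ^ 3 + 48 * n ^ 2 + 2 * n + n * (2 * evenSum)
  Sc≡ = trans (cong (_/ 2) (trans schultzDoubleSum-closed (*-comm 2 X))) (m*n/n≡m X 2)
    where
      X : ℕ
      X = 34 * n ^ 3 + 48 * n ^ 2 + 2 * n + n * (2 * evenSum)

even⇒halves : ∀ n → n % 2 ≡ 0 → n ≡ n / 2 + n / 2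
even⇒halves n r≡0 = begin
  n                       ≡⟨ m≡m%n+[m/n]*n n 2 ⟩
  n % 2 + n / 2 * 2       ≡⟨ cong (_+ n / 2 * 2) r≡0 ⟩
  n / 2 * 2               ≡⟨ *-comm (n / 2) 2 ⟩
  n / 2 + (n / 2 + 0)     ≡⟨ cong (n / 2 +_) (+-identityʳ (n / 2)) ⟩
  n / 2 + n / 2           ∎

odd⇒halves : ∀ n → n % 2 ≡ 1 → n ≡ suc (n / 2) + n / 2
odd⇒halves n r≡1 = begin
  n                       ≡⟨ m≡m%n+[m/n]*n n 2 ⟩
  n % 2 + n / 2 * 2       ≡⟨ cong (_+ n / 2 * 2) r≡1 ⟩
  suc (n / 2 * 2)         ≡⟨ cong suc (*-comm (n / 2) 2) ⟩
  suc (n / 2 + (n / 2 + 0)) ≡⟨ cong (λ k → suc (n / 2 + k)) (+-identityʳ (n / 2)) ⟩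
  suc (n / 2) + n / 2     ∎

-- The ring solver does not see through _^_, so cubes and squares are spelt out.
closed-form-even : ∀ n e → 2 * e ≡ n * n →
                   34 * n ^ 3 + 48 * n ^ 2 + 2 * n + n * (2 * e) ≡ 35 * n ^ 3 + 48 * n ^ 2 + 2 * n
closed-form-even n e 2e≡n² = trans (cong (λ s → 34 * n ^ 3 + 48 * n ^ 2 + 2 * n + n * s) 2e≡n²) (cubes n)
  where
    cubes : ∀ n → 34 * (n * (n * (n * 1))) + 48 * (n * (n * 1)) + 2 * n + n * (n * n)
                ≡ 35 * (n * (n * (n * 1))) + 48 * (n * (n * 1)) + 2 * n
    cubes = solve-∀

closed-form-odd : ∀ n e → suc (2 * e) ≡ n * n →
                  34 * n ^ 3 + 48 * n ^ 2 + 2 * n + n * (2 * e) ≡ 35 * n ^ 3 + 48 * n ^ 2 + n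
closed-form-odd n e 1+2e≡n² =
  trans (regroup n e) (trans (cong (λ s → 34 * n ^ 3 + 48 * n ^ 2 + n + n * s) 1+2e≡n²) (cubes n))
  where
    regroup : ∀ n e → 34 * (n * (n * (n * 1))) + 48 * (n * (n * 1)) + 2 * n + n * (2 * e)
                    ≡ 34 * (n * (n * (n * 1))) + 48 * (n * (n * 1)) + n + n * suc (2 * e)
    regroup = solve-∀
    cubes : ∀ n → 34 * (n * (n * (n * 1))) + 48 * (n * (n * 1)) + n + n * (n * n)
                ≡ 35 * (n * (n * (n * 1))) + 48 * (n * (n * 1)) + n
    cubes = solve-∀

theorem10 : (n : ℕ) → 2 ≤ n →
    (n % 2 ≡ 0 → Sc n ≡ 35 * n ^ 3 + 48 * n ^ 2 + 2 * n) ×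
    (n % 2 ≡ 1 → Sc n ≡ 35 * n ^ 3 + 48 * n ^ 2 + n)
theorem10 (suc (suc p)) _ =
    (λ even → trans Sc≡ (closed-form-even n evenSum (evenSum-even (n / 2) (even⇒halves n even))))
  , (λ odd  → trans Sc≡ (closed-form-odd  n evenSum (evenSum-odd  (n / 2) (odd⇒halves n odd))))
  where open Schultz p
theorem10 1 (s≤s ())
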